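{- Let $1\le k\le n$. The concatenation $\Gamma_{k-1,k}:=\Gamma_k^*(k)\ast\Theta_k$, i.e. the sequence of roots \[ ((k,k+1),\dots,(k,n),(k,\bar k),(k,\bar n),\dots,(k,\overline{k+1}),(k-1,\bar k),\dots,(1,\bar k),-(1,k),\dots,-(k-1,k)), \] is a reduced $(-\varpi_{k-1}+\varpi_k)$-chain.
   Context: $\mathfrak g$ is of type $C_n$: $P=\bigoplus_{k=1}^n\mathbb Z\varepsilon_k$, $\Delta^+=\{\varepsilon_i-\varepsilon_j,\varepsilon_i+\varepsilon_j\ (1\le i<j\le n),\ 2\varepsilon_k\}$, $\Delta=\Delta^+\cup-\Delta^+$, coroots $\alpha^\vee$, canonical pairing $\langle\cdot,\cdot\rangle$, fundamental weights $\varpi_k=\varepsilon_1+\cdots+\varepsilon_k$, $\varpi_0:=0$ (so $-\varpi_{k-1}+\varpi_k=\varepsilon_k$). For $1\le i<j\le n$: $(i,j):=\varepsilon_i-\varepsilon_j$, $(i,\bar j):=\varepsilon_i+\varepsilon_j$, $(i,\bar i):=2\varepsilon_i$. $\Gamma_k^*(k):=((k,k+1),\dots,(k,n),(k,\bar k),(k,\bar n),\dots,(k,\overline{k+1}),(k-1,\bar k),\dots,(1,\bar k))$, $\Theta_k:=(-(1,k),\dots,-(k-1,k))$, and $\ast$ is concatenation. Alcoves: $\mathfrak h^*_{\mathbb R}=P\otimes\mathbb R$; $H_{\alpha,l}=\{\xi\mid\langle\xi,\alpha^\vee\rangle=l\}$ ($\alpha\in\Delta$, $l\in\mathbb Z$);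 alcoves are the connected components of the complement of all $H_{\alpha,l}$; two alcoves are adjacent if their closures share a common wall. For adjacent $A,B$, $A\xrightarrow{\alpha}B$ means the common wall lies in some $H_{\alpha,l}$ and $\alpha$ points from $A$ to $B$. $A_\circ=\{\xi\mid0<\langle\xi,\alpha^\vee\rangle<1\ \forall\alpha\in\Delta^+\}$, $A_\nu=A_\circ+\nu$. For $\mu\in P$, a $\mu$-chain is a sequence of roots $(\gamma_1,\dots,\gamma_r)$ for which there is a sequence of alcoves with $A_\circ=A_0\xrightarrow{ -\gamma_1}A_1\xrightarrow{ -\gamma_2}\cdots\xrightarrow{ -\gamma_r}A_r=A_{ -\mu}$, consecutive ones adjacent; it is reduced if this alcove path has minimal length among all alcove paths from $A_\circ$ to $A_{ -\mu}$. -}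

module Defs where

open import Data.Nat as ℕ using (ℕ; zero; suc; _∸_)
import Data.Nat as N
open import Data.Integer as ℤ using (ℤ; +_)
open import Data.Rational as ℚ using (ℚ; 0ℚ; 1ℚ)
open import Data.Fin using (Fin; toℕ)
open import Data.Vec using (Vec; tabulate; zipWith; map; foldr)
open import Data.List as L using (List; []; _∷_; _++_; upTo; reverse; length)
open import Data.Product using (Σ; _×_; _,_; ∃)
open import Data.Sum using (_⊎_)
open import Data.Bool using (if_then_else_)
open import Relation.Nullary using (¬_)
open import Relation.Nullary.Decidable using (⌊_⌋)
open import Relation.Binary.PropositionalEquality using (_≡_)

-- The lattice P = ⊕ ℤ ε_k  (weights) as Vec ℤ n, and h*_ℝ approximated by
-- rational points Vec ℚ n (every alcove, being open, contains rational points).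

Wt : ℕ → Set
Wt n = Vec ℤ n

Pt : ℕ → Set
Pt n = Vec ℚ n

-- ε i  (1-based index i; ε i = 0 if i ∉ {1..n})
ε : ∀ {n} → ℕ → Wt n
ε i = tabulate (λ j → if ⌊ suc (toℕ j) N.≟ i ⌋ then + 1 else + 0)

_⊕_ : ∀ {n} → Wt n → Wt n → Wt n
_⊕_ = zipWith ℤ._+_

⊖_ : ∀ {n} → Wt n → Wt n
⊖ a = map ℤ.-_ a

_⊝_ : ∀ {n} → Wt n → Wt n → Wt n
a ⊝ b = a ⊕ (⊖ b)

𝟎 : ∀ {n} → Wt n
𝟎 = tabulate (λ _ → + 0)

-- (i,j) := ε_i − ε_j ,  (i,j̄) := ε_i + ε_j ,  (i,ī) := 2 ε_i = ε_i + ε_i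
⟨_,_⟩⁻ : ∀ {n} → ℕ → ℕ → Wt n
⟨ i , j ⟩⁻ = ε i ⊝ ε j

⟨_,_⟩⁺ : ∀ {n} → ℕ → ℕ → Wt n
⟨ i , j ⟩⁺ = ε i ⊕ ε j

ϖ : ∀ {n} → ℕ → Wt n
ϖ zero = 𝟎
ϖ (suc k) = ϖ k ⊕ ε (suc k)

data IsPosRoot (n : ℕ) : Wt n → Set where
  short⁻ : ∀ {i j} → 1 N.≤ i → i N.< j → j N.≤ n → IsPosRoot n ⟨ i , j ⟩⁻
  short⁺ : ∀ {i j} → 1 N.≤ i → i N.< j → j N.≤ n → IsPosRoot n ⟨ i , j ⟩⁺
  long   : ∀ {i} → 1 N.≤ i → i N.≤ n → IsPosRoot n ⟨ i , i ⟩⁺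

IsRoot : (n : ℕ) → Wt n → Set
IsRoot n α = IsPosRoot n α ⊎ IsPosRoot n (⊖ α)

toℚ : ℤ → ℚ
toℚ z = z ℚ./ 1

dot : ∀ {n} → Pt n → Wt n → ℚ
dot ξ α = foldr _ ℚ._+_ 0ℚ (zipWith (λ x a → x ℚ.* toℚ a) ξ α)

normSq : ∀ {n} → Wt n → ℕ
normSq α = foldr _ N._+_ 0 (map (λ a → ℤ.∣ a ∣ N.* ℤ.∣ a ∣) α)

-- 1/m for m ≠ 0 (value at 0 irrelevant: roots have nonzero norm)
inv : ℕ → ℚ
inv zero = 0ℚ
inv (suc m) = + 1 ℚ./ suc m

coroot⟨_,_⟩ : ∀ {n} → Pt n → Wt n → ℚ
coroot⟨ ξ , α ⟩ = (toℚ (+ 2) ℚ.* dot ξ α) ℚ.* inv (normSq α)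

ptOf : ∀ {n} → Wt n → Pt n
ptOf = map toℚ

_+ₚ_ : ∀ {n} → Pt n → Pt n → Pt n
_+ₚ_ = zipWith ℚ._+_

-- Alcoves.  An alcove is represented by any rational point in it.
-- A point is generic if it lies on no hyperplane H_{α,l}.

Generic : ∀ {n} → Pt n → Set
Generic {n} ξ = ∀ α → IsPosRoot n α → ∀ (l : ℤ) → ¬ (coroot⟨ ξ , α ⟩ ≡ toℚ l)

InA∘ : ∀ {n} → Pt n → Set
InA∘ {n} ξ = ∀ α → IsPosRoot n α → (0ℚ ℚ.< coroot⟨ ξ , α ⟩) × (coroot⟨ ξ , α ⟩ ℚ.< 1ℚ)

InA : ∀ {n} → Wt n → Pt n → Set
InA ν ξ = InA∘ (ξ +ₚ ptOf (⊖ ν))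

Separates : ∀ {n} → Pt n → Pt n → Wt n → ℤ → Set
Separates ξ η α l =
  (coroot⟨ ξ , α ⟩ ℚ.< toℚ l × toℚ l ℚ.< coroot⟨ η , α ⟩)
  ⊎ (coroot⟨ η , α ⟩ ℚ.< toℚ l × toℚ l ℚ.< coroot⟨ ξ , α ⟩)

-- A --β--> B : A and B adjacent (separated by exactly one hyperplane, which
-- is then their common wall), the wall lies in H_{β,l}, and β points from A to B.
Step : ∀ {n} → Pt n → Wt n → Pt n → Set
Step {n} ξ β η =
  Generic ξ × Generic η × IsRoot n β ×
  Σ ℤ (λ l →
    (coroot⟨ ξ , β ⟩ ℚ.< toℚ l × toℚ l ℚ.< coroot⟨ η , β ⟩) ×
    (∀ α → IsPosRoot n α → ∀ m → Separates ξ η α m →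
       (α ≡ β × m ≡ l) ⊎ (α ≡ ⊖ β × m ≡ ℤ.- l)))

data Walk {n : ℕ} : Pt n → List (Wt n) → Pt n → Set where
  stop : ∀ {ξ} → Generic ξ → Walk ξ [] ξ
  step : ∀ {ξ η ζ β βs} → Step ξ β η → Walk η βs ζ → Walk ξ (β ∷ βs) ζ

IsChain : ∀ {n} → Wt n → List (Wt n) → Set
IsChain μ γs = ∃ λ ξ → ∃ λ η → InA∘ ξ × InA (⊖ μ) η × Walk ξ (L.map ⊖_ γs) η

IsReducedChain : ∀ {n} → Wt n → List (Wt n) → Set
IsReducedChain μ γs =
  IsChain μ γs ×
  (∀ ξ η βs → InA∘ ξ → InA (⊖ μ) η → Walk ξ βs η → length γs N.≤ length βs)

range : ℕ → ℕ → List ℕ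
range a m = L.map (a N.+_) (upTo m)

Γ*[_,_] : ∀ n → ℕ → List (Wt n)
Γ*[ n , k ] =
     L.map (λ j → ⟨ k , j ⟩⁻) (range (suc k) (n ∸ k))
  ++ (⟨ k , k ⟩⁺ ∷ [])
  ++ L.map (λ j → ⟨ k , j ⟩⁺) (reverse (range (suc k) (n ∸ k)))
  ++ L.map (λ i → ⟨ i , k ⟩⁺) (reverse (range 1 (k ∸ 1)))

Θ[_,_] : ∀ n → ℕ → List (Wt n)
Θ[ n , k ] = L.map (λ i → ⊖ ⟨ i , k ⟩⁻) (range 1 (k ∸ 1))

Γ[_,_] : ∀ n → ℕ → List (Wt n)
Γ[ n , k ] = Γ*[ n , k ] ++ Θ[ n , k ]

-- The chain is realised on the line of points R u (u ∈ ℤ) whose k-th coordinate is u / D,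
-- D = 4n − 2, and whose other coordinates are fixed and strictly decreasing, with a gap at
-- position k.  The only walls the line meets are hyperplanes H_{γ,ℓ} of the 2n − 1 roots
-- γ = ε_k ± ε_p, 2ε_k occurring in Γ, whose coroot along the line is (u − σ w_p) / D.  The
-- coordinates are chosen so that these walls are crossed one at a time, at the consecutive even
-- parameters 2c, 2c − 2, … (c = n − k) and in the order of Γ, while the points with odd
-- parameter lie on no wall.  So the line passes through the alcoves of a walk from A_∘ (at
-- u = 2c + 1) to A_∘ − ε_k = A_{−μ} (at u = 2c + 1 − D).  It is a shortest one: since
-- ⟨ε_k, γ^∨⟩ = 1 for each of these γ, all 2n − 1 walls separate A_∘ from A_∘ − ε_k, and
-- each step of a walk crosses a single hyperplane.

module Submission where

open import Defs
open import Data.Nat using (ℕ; _≤_; _∸_)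
open import Data.Nat as ℕ using (zero; suc; z≤n; s≤s)
import Data.Nat.Properties as ℕP
open import Data.Nat.Coprimality using (1-coprimeTo) renaming (sym to coprime-sym)
open import Data.Integer as ℤ using (ℤ; +_; -[1+_]; _◃_)
open import Data.Sign as Sign using (Sign)
import Data.Integer.Properties as ℤP
open import Data.Integer.Tactic.RingSolver using (solve-∀)
open import Data.Rational as ℚ using (ℚ; mkℚ; 0ℚ; 1ℚ)
import Data.Rational.Properties as ℚP
import Data.Rational.Solver as ℚSolver
open import Data.Vec as V using ([]; _∷_)
open import Data.Fin as Fin using (Fin; toℕ)
open import Data.Vec.Properties using (tabulate-cong; tabulate-∘)
open import Data.Product using (Σ; _×_; _,_; proj₁; proj₂)
open import Data.Sum as Sum using (_⊎_; inj₁; inj₂)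
open import Data.List as L using (List; []; _∷_; _++_; length; filter)
import Data.List.Properties as LP
open import Data.List.Relation.Unary.All as All using (All; []; _∷_)
import Data.List.Relation.Unary.All.Properties as AllP
open import Data.List.Relation.Unary.AllPairs as AllPairs using (AllPairs; []; _∷_)
import Data.List.Relation.Unary.AllPairs.Properties as AllPairsP
open import Data.List.Relation.Unary.Any using (here; there)
open import Data.List.Membership.Propositional using (_∈_)
open import Relation.Binary.Definitions using (tri<; tri≈; tri>)
open import Data.Empty using (⊥; ⊥-elim)
open import Relation.Nullary using (¬_; yes; no)
open import Relation.Nullary.Decidable using (⌊_⌋; isYes≗does; _×-dec_; _⊎-dec_)
open import Relation.Unary using (Decidable)
open import Data.Bool using (if_then_else_)
open import Relation.Binary.PropositionalEquality
open import Function using (_∘_)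
import Data.Nat.Tactic.RingSolver as NS

open ℚSolver.+-*-Solver using (solve; _:+_; _:*_; :-_; _:-_; _:=_; con)

-- toℚ z in normal form, on which the operations of ℚ compute.
ι : ℤ → ℚ
ι z = mkℚ z 0 (coprime-sym (1-coprimeTo _))

toℚ≡ι : ∀ z → toℚ z ≡ ι z
toℚ≡ι z = ℚP.↥p/↧p≡p (ι z)

toℚ-+ : ∀ a b → toℚ (a ℤ.+ b) ≡ toℚ a ℚ.+ toℚ b
toℚ-+ a b = begin
  toℚ (a ℤ.+ b)                  ≡⟨ cong toℚ (sym (cong₂ ℤ._+_ (ℤP.*-identityʳ a) (ℤP.*-identityʳ b))) ⟩
  toℚ (a ℤ.* + 1 ℤ.+ b ℤ.* + 1)  ≡⟨⟩
  ι a ℚ.+ ι b                    ≡⟨ sym (cong₂ ℚ._+_ (toℚ≡ι a) (toℚ≡ι b)) ⟩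
  toℚ a ℚ.+ toℚ b                ∎
  where open ≡-Reasoning

toℚ-* : ∀ a b → toℚ (a ℤ.* b) ≡ toℚ a ℚ.* toℚ b
toℚ-* a b = sym (cong₂ ℚ._*_ (toℚ≡ι a) (toℚ≡ι b))

toℚ-neg : ∀ a → toℚ (ℤ.- a) ≡ ℚ.- toℚ a
toℚ-neg a = trans (toℚ≡ι _) (trans (ι-neg a) (cong ℚ.-_ (sym (toℚ≡ι a))))
  where
  ι-neg : ∀ a → ι (ℤ.- a) ≡ ℚ.- ι a
  ι-neg (+ zero)  = refl
  ι-neg (+ suc _) = refl
  ι-neg -[1+ _ ]  = refl

toℚ-mono-< : ∀ {a b} → a ℤ.< b → toℚ a ℚ.< toℚ b
toℚ-mono-< {a} {b} a<b = subst₂ ℚ._<_ (sym (toℚ≡ι a)) (sym (toℚ≡ι b))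
  (ℚ.*<* (subst₂ ℤ._<_ (sym (ℤP.*-identityʳ a)) (sym (ℤP.*-identityʳ b)) a<b))

toℚ-cancel-< : ∀ {a b} → toℚ a ℚ.< toℚ b → a ℤ.< b
toℚ-cancel-< {a} {b} lt with subst₂ ℚ._<_ (toℚ≡ι a) (toℚ≡ι b) lt
... | ℚ.*<* a<b = subst₂ ℤ._<_ (ℤP.*-identityʳ a) (ℤP.*-identityʳ b) a<b

+[a∸b] : ∀ a b → b ≤ a → + (a ∸ b) ≡ + a ℤ.- + b
+[a∸b] a b b≤a = sym (trans (ℤP.m-n≡m⊖n a b) (ℤP.⊖-≥ b≤a))

no-integer-in-unit-interval : ∀ l → 0ℚ ℚ.< toℚ l → toℚ l ℚ.< 1ℚ → ⊥
no-integer-in-unit-interval l 0<l l<1 =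
  ℤP.<⇒≱ (toℚ-cancel-< {l} {+ 1} l<1) (ℤP.i<j⇒suc[i]≤j (toℚ-cancel-< {+ 0} {l} 0<l))

1≢2* : ∀ d → + 1 ≢ + 2 ℤ.* d
1≢2* (+ zero)  ()
1≢2* (+ suc d) eq = ℕP.0≢1+n (trans (ℕP.suc-injective (ℤP.+-injective eq)) (ℕP.+-suc d (d ℕ.+ 0)))
1≢2* -[1+ d ]  ()

odd≢even : ∀ x y → + 1 ℤ.+ + 2 ℤ.* x ≢ + 2 ℤ.* y
odd≢even x y eq = 1≢2* (y ℤ.- x) (trans (isolate x) (trans (cong (ℤ._- + 2 ℤ.* x) eq) (factor y x)))
  where
  isolate : ∀ x → + 1 ≡ (+ 1 ℤ.+ + 2 ℤ.* x) ℤ.- + 2 ℤ.* x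
  isolate = solve-∀
  factor : ∀ y x → + 2 ℤ.* y ℤ.- + 2 ℤ.* x ≡ + 2 ℤ.* (y ℤ.- x)
  factor = solve-∀

≡-from-difference : ∀ a b → a ℤ.- b ≡ + 0 → a ≡ b
≡-from-difference a b a-b≡0 = trans (split a b) (trans (cong (ℤ._+ b) a-b≡0) (ℤP.+-identityˡ b))
  where
  split : ∀ a b → a ≡ (a ℤ.- b) ℤ.+ b
  split = solve-∀

squeeze : ∀ {a b} → a ℤ.- + 1 ℤ.< b → b ℤ.< a ℤ.+ + 1 → b ≡ a
squeeze {a} {b} lo hi = ℤP.≤-antisym
  (subst (b ℤ.≤_) (trans (cong ℤ.pred (ℤP.+-comm a (+ 1))) (ℤP.pred-suc a)) (ℤP.i<j⇒i≤pred[j] hi))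
  (subst (ℤ._≤ b) (trans (cong ℤ.suc (ℤP.+-comm a (ℤ.- + 1))) (ℤP.suc-pred a)) (ℤP.i<j⇒suc[i]≤j lo))

i-1<i : ∀ i → i ℤ.- + 1 ℤ.< i
i-1<i i = subst (i ℤ.- + 1 ℤ.<_) (ℤP.+-identityʳ i) (ℤP.+-monoʳ-< i ℤ.-<+)

i-2<i : ∀ i → i ℤ.- + 2 ℤ.< i
i-2<i i = subst (i ℤ.- + 2 ℤ.<_) (ℤP.+-identityʳ i) (ℤP.+-monoʳ-< i ℤ.-<+)

i<i+1 : ∀ i → i ℤ.< i ℤ.+ + 1
i<i+1 i = subst (ℤ._< i ℤ.+ + 1) (ℤP.+-identityʳ i) (ℤP.+-monoʳ-< i (ℤ.+<+ (s≤s z≤n)))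

small-multiple : ∀ {d} a m → ℤ.∣ a ∣ ℕ.< d → a ≡ m ℤ.* + d → m ≡ + 0
small-multiple {d} a m ∣a∣<d refl = ℤP.∣i∣≡0⇒i≡0 (ℕP.n<1⇒n≡0 (ℕP.*-cancelʳ-< d ℤ.∣ m ∣ 1
  (subst₂ ℕ._<_ (ℤP.abs-* m (+ d)) (sym (ℕP.*-identityˡ d)) ∣a∣<d)))

⊖-involutive : ∀ {n} (a : Wt n) → ⊖ (⊖ a) ≡ a
⊖-involutive []      = refl
⊖-involutive (x ∷ a) = cong₂ _∷_ (ℤP.neg-involutive x) (⊖-involutive a)

⊖-⊕-cancelˡ : ∀ {n} (a b : Wt n) → (⊖ a) ⊕ (a ⊕ b) ≡ b
⊖-⊕-cancelˡ []      []      = refl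
⊖-⊕-cancelˡ (x ∷ a) (y ∷ b) = cong₂ _∷_ (cancel x y) (⊖-⊕-cancelˡ a b)
  where
  cancel : ∀ x y → ℤ.- x ℤ.+ (x ℤ.+ y) ≡ y
  cancel = solve-∀

-- Coordinates and coroots

-- 1-based, like ε; coordinates outside 1 … n read as 0.
coord : ∀ {n} → Pt n → ℕ → ℚ
coord []      _             = 0ℚ
coord (_ ∷ _) zero          = 0ℚ
coord (x ∷ _) (suc zero)    = x
coord (_ ∷ ξ) (suc (suc i)) = coord ξ (suc i)

coord-tabulate : ∀ {n} (x : ℕ → ℚ) p → 1 ≤ p → p ≤ n →
                 coord (V.tabulate {n} (λ f → x (suc (toℕ f)))) p ≡ x p
coord-tabulate {suc n} x (suc zero)    _ _         = refl
coord-tabulate {suc n} x (suc (suc p)) _ (s≤s p≤n) = coord-tabulate (λ q → x (suc q)) (suc p) (s≤s z≤n) p≤n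

unit : ∀ {n} → ℕ → Wt n
unit {zero}  _             = []
unit {suc n} zero          = + 0 ∷ unit zero
unit {suc n} (suc zero)    = + 1 ∷ unit zero
unit {suc n} (suc (suc i)) = + 0 ∷ unit (suc i)

ε≡unit : ∀ {n} i → ε {n} i ≡ unit i
ε≡unit {zero}  i             = refl
ε≡unit {suc n} zero          = cong (+ 0 ∷_) (ε≡unit {n} zero)
ε≡unit {suc n} (suc zero)    = cong (+ 1 ∷_) (ε≡unit {n} zero)
ε≡unit {suc n} (suc (suc i)) = cong (+ 0 ∷_) (trans
  (tabulate-cong λ j → cong (λ b → if b then + 1 else + 0)
    (trans (isYes≗does (suc (suc (toℕ j)) ℕ.≟ suc (suc i))) (sym (isYes≗does (suc (toℕ j) ℕ.≟ suc i)))))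
  (ε≡unit {n} (suc i)))

dot-⊕ : ∀ {n} (ξ : Pt n) a b → dot ξ (a ⊕ b) ≡ dot ξ a ℚ.+ dot ξ b
dot-⊕ []      []       []       = refl
dot-⊕ (x ∷ ξ) (a ∷ as) (b ∷ bs) = begin
  x ℚ.* toℚ (a ℤ.+ b) ℚ.+ dot ξ (as ⊕ bs)
    ≡⟨ cong₂ (λ t s → x ℚ.* t ℚ.+ s) (toℚ-+ a b) (dot-⊕ ξ as bs) ⟩
  x ℚ.* (toℚ a ℚ.+ toℚ b) ℚ.+ (dot ξ as ℚ.+ dot ξ bs)
    ≡⟨ solve 5 (λ x a b p q → x :* (a :+ b) :+ (p :+ q) := (x :* a :+ p) :+ (x :* b :+ q)) refl
             x (toℚ a) (toℚ b) (dot ξ as) (dot ξ bs) ⟩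
  (x ℚ.* toℚ a ℚ.+ dot ξ as) ℚ.+ (x ℚ.* toℚ b ℚ.+ dot ξ bs) ∎
  where open ≡-Reasoning

dot-⊖ : ∀ {n} (ξ : Pt n) a → dot ξ (⊖ a) ≡ ℚ.- dot ξ a
dot-⊖ []      []       = refl
dot-⊖ (x ∷ ξ) (a ∷ as) = begin
  x ℚ.* toℚ (ℤ.- a) ℚ.+ dot ξ (⊖ as)   ≡⟨ cong₂ (λ t s → x ℚ.* t ℚ.+ s) (toℚ-neg a) (dot-⊖ ξ as) ⟩
  x ℚ.* ℚ.- toℚ a ℚ.+ ℚ.- dot ξ as     ≡⟨ solve 3 (λ x a p → x :* (:- a) :+ (:- p) := :- (x :* a :+ p)) refl
                                               x (toℚ a) (dot ξ as) ⟩
  ℚ.- (x ℚ.* toℚ a ℚ.+ dot ξ as)       ∎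
  where open ≡-Reasoning

dot-+ₚ : ∀ {n} (ξ η : Pt n) a → dot (ξ +ₚ η) a ≡ dot ξ a ℚ.+ dot η a
dot-+ₚ []      []      []       = refl
dot-+ₚ (x ∷ ξ) (y ∷ η) (a ∷ as) = begin
  (x ℚ.+ y) ℚ.* toℚ a ℚ.+ dot (ξ +ₚ η) as        ≡⟨ cong ((x ℚ.+ y) ℚ.* toℚ a ℚ.+_) (dot-+ₚ ξ η as) ⟩
  (x ℚ.+ y) ℚ.* toℚ a ℚ.+ (dot ξ as ℚ.+ dot η as) ≡⟨ solve 5 (λ x y a p q → (x :+ y) :* a :+ (p :+ q) := (x :* a :+ p) :+ (y :* a :+ q)) refl
                                                         x y (toℚ a) (dot ξ as) (dot η as) ⟩
  (x ℚ.* toℚ a ℚ.+ dot ξ as) ℚ.+ (y ℚ.* toℚ a ℚ.+ dot η as) ∎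
  where open ≡-Reasoning

coord-zero : ∀ {n} (ξ : Pt n) → coord ξ 0 ≡ 0ℚ
coord-zero []      = refl
coord-zero (_ ∷ _) = refl

dot-unit : ∀ {n} (ξ : Pt n) i → dot ξ (unit i) ≡ coord ξ i
dot-unit []      _             = refl
dot-unit (x ∷ ξ) zero          = trans (cong (x ℚ.* 0ℚ ℚ.+_) (trans (dot-unit ξ 0) (coord-zero ξ)))
                                       (solve 1 (λ x → x :* con 0ℚ :+ con 0ℚ := con 0ℚ) refl x)
dot-unit (x ∷ ξ) (suc zero)    = trans (cong (x ℚ.* 1ℚ ℚ.+_) (trans (dot-unit ξ 0) (coord-zero ξ)))
                                       (solve 1 (λ x → x :* con 1ℚ :+ con 0ℚ := x) refl x)
dot-unit (x ∷ ξ) (suc (suc i)) = trans (cong (x ℚ.* 0ℚ ℚ.+_) (dot-unit ξ (suc i))) (*0+ x _)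
  where
  *0+ : ∀ x y → x ℚ.* 0ℚ ℚ.+ y ≡ y
  *0+ = solve 2 (λ x y → x :* con 0ℚ :+ y := y) refl


normSq-⊖ : ∀ {n} (a : Wt n) → normSq (⊖ a) ≡ normSq a
normSq-⊖ []      = refl
normSq-⊖ (x ∷ a) = cong₂ (λ s t → s ℕ.* s ℕ.+ t) (ℤP.∣-i∣≡∣i∣ x) (normSq-⊖ a)

normSq-unit0⊕ : ∀ {n} (a : Wt n) → normSq (unit 0 ⊕ a) ≡ normSq a
normSq-unit0⊕ []      = refl
normSq-unit0⊕ (x ∷ a) = cong₂ (λ s t → ℤ.∣ s ∣ ℕ.* ℤ.∣ s ∣ ℕ.+ t) (ℤP.+-identityˡ x) (normSq-unit0⊕ a)

normSq-unit0 : ∀ {n} → normSq (unit {n} 0) ≡ 0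
normSq-unit0 {zero}  = refl
normSq-unit0 {suc n} = normSq-unit0 {n}

normSq-unit : ∀ {n} j → 1 ≤ j → j ≤ n → normSq (unit {n} j) ≡ 1
normSq-unit {suc n} (suc zero)    _ _         = cong suc (normSq-unit0 {n})
normSq-unit {suc n} (suc (suc j)) _ (s≤s j≤n) = normSq-unit {n} (suc j) (s≤s z≤n) j≤n

normSq-short⁻ : ∀ {n} i j → 1 ≤ i → i ℕ.< j → j ≤ n → normSq (unit {n} i ⊕ (⊖ unit j)) ≡ 2
normSq-short⁻ {suc n} (suc zero)    (suc (suc j)) _ _         (s≤s j≤n) =
  cong suc (trans (normSq-unit0⊕ {n} (⊖ unit (suc j))) (trans (normSq-⊖ (unit {n} (suc j))) (normSq-unit (suc j) (s≤s z≤n) j≤n)))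
normSq-short⁻ {suc n} (suc zero)    (suc zero)    _ (s≤s ())  _
normSq-short⁻ {suc n} (suc (suc i)) (suc (suc j)) _ (s≤s i<j) (s≤s j≤n) = normSq-short⁻ (suc i) (suc j) (s≤s z≤n) i<j j≤n

normSq-short⁺ : ∀ {n} i j → 1 ≤ i → i ℕ.< j → j ≤ n → normSq (unit {n} i ⊕ unit j) ≡ 2
normSq-short⁺ {suc n} (suc zero)    (suc (suc j)) _ _         (s≤s j≤n) =
  cong suc (trans (normSq-unit0⊕ {n} (unit (suc j))) (normSq-unit (suc j) (s≤s z≤n) j≤n))
normSq-short⁺ {suc n} (suc zero)    (suc zero)    _ (s≤s ())  _
normSq-short⁺ {suc n} (suc (suc i)) (suc (suc j)) _ (s≤s i<j) (s≤s j≤n) = normSq-short⁺ (suc i) (suc j) (s≤s z≤n) i<j j≤n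

normSq-long : ∀ {n} i → 1 ≤ i → i ≤ n → normSq (unit {n} i ⊕ unit i) ≡ 4
normSq-long {suc n} (suc zero)    _ _         = cong (4 ℕ.+_) (trans (normSq-unit0⊕ {n} (unit 0)) (normSq-unit0 {n}))
normSq-long {suc n} (suc (suc i)) _ (s≤s i≤n) = normSq-long (suc i) (s≤s z≤n) i≤n

coroot-normSq2 : ∀ {n} (ξ : Pt n) α → normSq α ≡ 2 → coroot⟨ ξ , α ⟩ ≡ dot ξ α
coroot-normSq2 ξ α eq rewrite eq =
  trans (solve 3 (λ t d h → (t :* d) :* h := d :* (t :* h)) refl (toℚ (+ 2)) (dot ξ α) (inv 2)) (ℚP.*-identityʳ _)

coroot-normSq4 : ∀ {n} (ξ : Pt n) α g → normSq α ≡ 4 → dot ξ α ≡ g ℚ.+ g → coroot⟨ ξ , α ⟩ ≡ g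
coroot-normSq4 ξ α g eq dot≡ rewrite eq | dot≡ =
  trans (solve 3 (λ t g h → (t :* (g :+ g)) :* h := g :* ((t :* (con 1ℚ :+ con 1ℚ)) :* h)) refl (toℚ (+ 2)) g (inv 4))
        (ℚP.*-identityʳ _)

-- ⟨x, α^∨⟩ in coordinates: (ε_i ± ε_j)^∨ = ε_i ± ε_j and (2ε_i)^∨ = ε_i.
⟪_∣_⟫ : ∀ {n α} → (ℕ → ℚ) → IsPosRoot n α → ℚ
⟪ x ∣ short⁻ {i} {j} _ _ _ ⟫ = x i ℚ.- x j
⟪ x ∣ short⁺ {i} {j} _ _ _ ⟫ = x i ℚ.+ x j
⟪ x ∣ long {i} _ _ ⟫         = x i

coroot-coord : ∀ {n α} (ξ : Pt n) (pr : IsPosRoot n α) → coroot⟨ ξ , α ⟩ ≡ ⟪ coord ξ ∣ pr ⟫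
coroot-coord ξ (short⁻ {i} {j} 1≤i i<j j≤n) = begin
  coroot⟨ ξ , ε i ⊕ (⊖ ε j) ⟩        ≡⟨ cong₂ (λ a b → coroot⟨ ξ , a ⊕ (⊖ b) ⟩) (ε≡unit i) (ε≡unit j) ⟩
  coroot⟨ ξ , unit i ⊕ (⊖ unit j) ⟩  ≡⟨ coroot-normSq2 ξ _ (normSq-short⁻ i j 1≤i i<j j≤n) ⟩
  dot ξ (unit i ⊕ (⊖ unit j))        ≡⟨ dot-⊕ ξ (unit i) (⊖ unit j) ⟩
  dot ξ (unit i) ℚ.+ dot ξ (⊖ unit j) ≡⟨ cong₂ ℚ._+_ (dot-unit ξ i) (trans (dot-⊖ ξ (unit j)) (cong ℚ.-_ (dot-unit ξ j))) ⟩
  coord ξ i ℚ.- coord ξ j            ∎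
  where open ≡-Reasoning
coroot-coord ξ (short⁺ {i} {j} 1≤i i<j j≤n) = begin
  coroot⟨ ξ , ε i ⊕ ε j ⟩           ≡⟨ cong₂ (λ a b → coroot⟨ ξ , a ⊕ b ⟩) (ε≡unit i) (ε≡unit j) ⟩
  coroot⟨ ξ , unit i ⊕ unit j ⟩     ≡⟨ coroot-normSq2 ξ _ (normSq-short⁺ i j 1≤i i<j j≤n) ⟩
  dot ξ (unit i ⊕ unit j)           ≡⟨ dot-⊕ ξ (unit i) (unit j) ⟩
  dot ξ (unit i) ℚ.+ dot ξ (unit j) ≡⟨ cong₂ ℚ._+_ (dot-unit ξ i) (dot-unit ξ j) ⟩
  coord ξ i ℚ.+ coord ξ j           ∎
  where open ≡-Reasoning
coroot-coord ξ (long {i} 1≤i i≤n) = begin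
  coroot⟨ ξ , ε i ⊕ ε i ⟩       ≡⟨ cong (λ a → coroot⟨ ξ , a ⊕ a ⟩) (ε≡unit i) ⟩
  coroot⟨ ξ , unit i ⊕ unit i ⟩ ≡⟨ coroot-normSq4 ξ _ (coord ξ i) (normSq-long i 1≤i i≤n)
                                     (trans (dot-⊕ ξ (unit i) (unit i)) (cong₂ ℚ._+_ (dot-unit ξ i) (dot-unit ξ i))) ⟩
  coord ξ i                     ∎
  where open ≡-Reasoning

coroot-⊖ : ∀ {n} (ξ : Pt n) α → coroot⟨ ξ , ⊖ α ⟩ ≡ ℚ.- coroot⟨ ξ , α ⟩
coroot-⊖ ξ α rewrite normSq-⊖ α | dot-⊖ ξ α =
  solve 3 (λ t d h → (t :* (:- d)) :* h := :- ((t :* d) :* h)) refl (toℚ (+ 2)) (dot ξ α) (inv (normSq α))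

coroot-+ₚ : ∀ {n} (ξ η : Pt n) α → coroot⟨ ξ +ₚ η , α ⟩ ≡ coroot⟨ ξ , α ⟩ ℚ.+ coroot⟨ η , α ⟩
coroot-+ₚ ξ η α rewrite dot-+ₚ ξ η α =
  solve 4 (λ t a b h → (t :* (a :+ b)) :* h := (t :* a) :* h :+ (t :* b) :* h) refl
    (toℚ (+ 2)) (dot ξ α) (dot η α) (inv (normSq α))

0<p-q : ∀ {p q} → q ℚ.< p → 0ℚ ℚ.< p ℚ.- q
0<p-q {p} {q} q<p = subst (ℚ._< p ℚ.- q) (ℚP.+-inverseʳ q) (ℚP.+-monoˡ-< (ℚ.- q) q<p)

p-q<p : ∀ {p q} → 0ℚ ℚ.< q → p ℚ.- q ℚ.< p
p-q<p {p} {q} 0<q = subst (p ℚ.- q ℚ.<_) (ℚP.+-identityʳ p) (ℚP.+-monoʳ-< p (ℚP.neg-antimono-< 0<q))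

neg-cancel-< : ∀ {a b} → ℚ.- a ℚ.< ℚ.- b → b ℚ.< a
neg-cancel-< {a} {b} lt = subst₂ ℚ._<_ (neg-involutive b) (neg-involutive a) (ℚP.neg-antimono-< lt)
  where
  neg-involutive : ∀ a → ℚ.- (ℚ.- a) ≡ a
  neg-involutive = solve 1 (λ a → :- (:- a) := a) refl

InA∘-intro : ∀ {n} (ξ : Pt n) →
  (∀ p → 1 ≤ p → p ≤ n → 0ℚ ℚ.< coord ξ p) →
  (∀ p → 1 ≤ p → p ≤ n → coord ξ p ℚ.< 1ℚ) →
  (∀ p q → 1 ≤ p → p ℕ.< q → q ≤ n → coord ξ q ℚ.< coord ξ p) →
  (∀ p q → 1 ≤ p → p ℕ.< q → q ≤ n → coord ξ p ℚ.+ coord ξ q ℚ.< 1ℚ) →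
  InA∘ ξ
InA∘-intro {n} ξ pos <1 decreasing sum<1 α pr =
  subst (λ c → 0ℚ ℚ.< c × c ℚ.< 1ℚ) (sym (coroot-coord ξ pr)) (bounds pr)
  where
  bounds : ∀ {α} (pr : IsPosRoot n α) → 0ℚ ℚ.< ⟪ coord ξ ∣ pr ⟫ × ⟪ coord ξ ∣ pr ⟫ ℚ.< 1ℚ
  bounds (short⁻ {i} {j} 1≤i i<j j≤n) =
    0<p-q (decreasing i j 1≤i i<j j≤n) ,
    ℚP.<-trans (p-q<p (pos j (ℕP.≤-trans 1≤i (ℕP.<⇒≤ i<j)) j≤n)) (<1 i 1≤i (ℕP.<⇒≤ (ℕP.<-≤-trans i<j j≤n)))
  bounds (short⁺ {i} {j} 1≤i i<j j≤n) =
    ℚP.+-mono-< (pos i 1≤i (ℕP.<⇒≤ (ℕP.<-≤-trans i<j j≤n))) (pos j (ℕP.≤-trans 1≤i (ℕP.<⇒≤ i<j)) j≤n) ,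
    sum<1 i j 1≤i i<j j≤n
  bounds (long {i} 1≤i i≤n) = pos i 1≤i i≤n , <1 i 1≤i i≤n

-- Hyperplanes, and a lower bound on the length of walks

IsRoot-⊖ : ∀ {n} {γ : Wt n} → IsRoot n γ → IsRoot n (⊖ γ)
IsRoot-⊖ (inj₁ pr) = inj₂ (subst (IsPosRoot _) (sym (⊖-involutive _)) pr)
IsRoot-⊖ (inj₂ pr) = inj₁ pr

Hyperplane : ℕ → Set
Hyperplane n = Wt n × ℤ

-- H_{α,m} and H_{−α,−m} are the same hyperplane.
_≈ₕ_ : ∀ {n} → Hyperplane n → Hyperplane n → Set
(α , m) ≈ₕ (β , l) = (α ≡ β × m ≡ l) ⊎ (α ≡ ⊖ β × m ≡ ℤ.- l)

≈ₕ-refl : ∀ {n} {h : Hyperplane n} → h ≈ₕ h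
≈ₕ-refl = inj₁ (refl , refl)

≈ₕ-flip : ∀ {n} (α : Wt n) m → (α , m) ≈ₕ (⊖ α , ℤ.- m)
≈ₕ-flip α m = inj₂ (sym (⊖-involutive α) , sym (ℤP.neg-involutive m))

≈ₕ-sym : ∀ {n} {h h' : Hyperplane n} → h ≈ₕ h' → h' ≈ₕ h
≈ₕ-sym (inj₁ (refl , refl)) = ≈ₕ-refl
≈ₕ-sym {h' = β , l} (inj₂ (refl , refl)) = ≈ₕ-flip β l

≈ₕ-trans : ∀ {n} {h h' h'' : Hyperplane n} → h ≈ₕ h' → h' ≈ₕ h'' → h ≈ₕ h''
≈ₕ-trans (inj₁ (refl , refl)) e                    = e
≈ₕ-trans (inj₂ (refl , refl)) (inj₁ (refl , refl)) = inj₂ (refl , refl)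
≈ₕ-trans {h'' = γ , o} (inj₂ (refl , refl)) (inj₂ (refl , refl)) = inj₁ (⊖-involutive γ , ℤP.neg-involutive o)

on-≈ₕ : ∀ {n} {ξ : Pt n} {α β m l} → (α , m) ≈ₕ (β , l) → coroot⟨ ξ , α ⟩ ≡ toℚ m → coroot⟨ ξ , β ⟩ ≡ toℚ l
on-≈ₕ (inj₁ (refl , refl)) on = on
on-≈ₕ {ξ = ξ} {β = β} {l = l} (inj₂ (refl , refl)) on =
  ℚP.neg-injective (trans (sym (coroot-⊖ ξ β)) (trans on (toℚ-neg l)))

≈ₕ-of-± : ∀ {n} {α γ : Wt n} → α ≡ γ ⊎ α ≡ ⊖ γ → ∀ m → Σ ℤ λ ℓ → (α , m) ≈ₕ (γ , ℓ)
≈ₕ-of-± (inj₁ refl) m = m , ≈ₕ-refl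
≈ₕ-of-± (inj₂ refl) m = ℤ.- m , inj₂ (refl , sym (ℤP.neg-involutive m))

Separated : ∀ {n} → Pt n → Pt n → Hyperplane n → Set
Separated ξ η (α , m) = Separates ξ η α m

separated? : ∀ {n} (ξ η : Pt n) → Decidable (Separated ξ η)
separated? ξ η (α , m) =
  ((coroot⟨ ξ , α ⟩ ℚP.<? toℚ m) ×-dec (toℚ m ℚP.<? coroot⟨ η , α ⟩)) ⊎-dec
  ((coroot⟨ η , α ⟩ ℚP.<? toℚ m) ×-dec (toℚ m ℚP.<? coroot⟨ ξ , α ⟩))

unseparated : ∀ {n} {ξ η : Pt n} {α m} → coroot⟨ ξ , α ⟩ ≡ coroot⟨ η , α ⟩ → ¬ Separated ξ η (α , m)
unseparated {m = m} same (inj₁ (p , q)) = ℚP.<-asym p (subst (toℚ m ℚ.<_) (sym same) q)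
unseparated {m = m} same (inj₂ (p , q)) = ℚP.<-asym (subst (ℚ._< toℚ m) (sym same) p) q

separated-flip : ∀ {n} {ξ η : Pt n} β l → Separated ξ η (⊖ β , ℤ.- l) → Separated ξ η (β , l)
separated-flip {ξ = ξ} {η} β l s rewrite coroot-⊖ ξ β | coroot-⊖ η β | toℚ-neg l with s
... | inj₁ (p , q) = inj₂ (neg-cancel-< q , neg-cancel-< p)
... | inj₂ (p , q) = inj₁ (neg-cancel-< q , neg-cancel-< p)

separated-≈ₕ : ∀ {n} {ξ η : Pt n} {h h'} → h ≈ₕ h' → Separated ξ η h → Separated ξ η h'
separated-≈ₕ (inj₁ (refl , refl)) s = s
separated-≈ₕ {ξ = ξ} {η} {h' = β , l} (inj₂ (refl , refl)) s = separated-flip {ξ = ξ} {η} β l s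

generic-off-walls : ∀ {n} {ξ : Pt n} {α} → Generic ξ → IsRoot n α → ∀ m → coroot⟨ ξ , α ⟩ ≢ toℚ m
generic-off-walls g (inj₁ pr) m = g _ pr m
generic-off-walls {ξ = ξ} {α} g (inj₂ pr) m on =
  g (⊖ α) pr (ℤ.- m) (trans (coroot-⊖ ξ α) (trans (cong ℚ.-_ on) (sym (toℚ-neg m))))

separated-split : ∀ {n} {ξ ξ' η : Pt n} {α m} → coroot⟨ ξ' , α ⟩ ≢ toℚ m →
  Separated ξ η (α , m) → ¬ Separated ξ' η (α , m) → Separated ξ ξ' (α , m)
separated-split {ξ' = ξ'} {α = α} {m} off s ¬s' with ℚP.<-cmp coroot⟨ ξ' , α ⟩ (toℚ m) | s
... | tri< lt _ _ | inj₁ (_ , q) = ⊥-elim (¬s' (inj₁ (lt , q)))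
... | tri< lt _ _ | inj₂ (_ , q) = inj₂ (lt , q)
... | tri≈ _ on _ | _            = ⊥-elim (off on)
... | tri> _ _ gt | inj₁ (p , _) = inj₁ (p , gt)
... | tri> _ _ gt | inj₂ (p , _) = ⊥-elim (¬s' (inj₂ (p , gt)))

length≤suc-filter : ∀ {A : Set} {P : A → Set} {R : A → A → Set} (P? : Decidable P) {xs : List A} →
  AllPairs (λ x y → ¬ R x y) xs → (∀ {x y} → x ∈ xs → y ∈ xs → ¬ P x → ¬ P y → R x y) →
  length xs ≤ suc (length (filter P? xs))
length≤suc-filter P? {[]}     _                   _          = z≤n
length≤suc-filter {P = P} P? {x ∷ xs} (x-apart ∷ apart) R-on-fails with P? x
... | yes _  = s≤s (length≤suc-filter P? apart (λ x∈ y∈ → R-on-fails (there x∈) (there y∈)))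
... | no ¬px = ℕP.≤-reflexive (cong suc (sym (cong length (LP.filter-all P? (All.tabulate holds)))))
  where
  holds : ∀ {y} → y ∈ xs → P y
  holds {y} y∈ with P? y
  ... | yes py  = py
  ... | no ¬py = ⊥-elim (All.lookup x-apart y∈ (R-on-fails (here refl) (there y∈) ¬px ¬py))

-- Each step of a walk crosses exactly one hyperplane, so it can leave behind at most one of
-- the pairwise distinct hyperplanes still separating the current alcove from the target.
walk-length≥ : ∀ {n} {ξ η : Pt n} {βs} → Walk ξ βs η → (H : List (Hyperplane n)) →
  AllPairs (λ h h' → ¬ h ≈ₕ h') H → All (λ h → IsRoot n (proj₁ h) × Separated ξ η h) H →
  length H ≤ length βs
walk-length≥ (stop _) []      _ _             = z≤n
walk-length≥ {ξ = ξ} (stop _) (h ∷ _) _ ((_ , s) ∷ _) = ⊥-elim (unseparated {ξ = ξ} {ξ} {proj₁ h} {proj₂ h} refl s)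
walk-length≥ {n} {ξ} {η} (step {η = ξ'} {β = β} (_ , generic' , _ , l , _ , unique) walk) H apart H-sep =
  ℕP.≤-trans (length≤suc-filter (separated? ξ' η) apart crossed-together)
             (s≤s (walk-length≥ walk (filter (separated? ξ' η) H) (AllPairsP.filter⁺ (separated? ξ' η) apart) H'-sep))
  where
  H'-sep : All (λ h → IsRoot n (proj₁ h) × Separated ξ' η h) (filter (separated? ξ' η) H)
  H'-sep = All.zip (AllP.filter⁺ (separated? ξ' η) (All.map proj₁ H-sep) , AllP.all-filter (separated? ξ' η) H)
  crossed : ∀ {α m} → IsRoot n α → Separated ξ ξ' (α , m) → (α , m) ≈ₕ (β , l)
  crossed (inj₁ pr) s = unique _ pr _ s
  crossed {α} {m} (inj₂ pr) s =
    ≈ₕ-trans (≈ₕ-flip α m) (unique (⊖ α) pr (ℤ.- m) (separated-≈ₕ {ξ = ξ} {ξ'} (≈ₕ-flip α m) s))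
  left-behind : ∀ {h} → h ∈ H → ¬ Separated ξ' η h → h ≈ₕ (β , l)
  left-behind {α , m} h∈H ¬s with All.lookup H-sep h∈H
  ... | root , s = crossed root (separated-split {ξ = ξ} {ξ'} {η} {α} {m} (generic-off-walls {ξ = ξ'} generic' root m) s ¬s)
  crossed-together : ∀ {h h'} → h ∈ H → h' ∈ H → ¬ Separated ξ' η h → ¬ Separated ξ' η h' → h ≈ₕ h'
  crossed-together h∈ h'∈ ¬s ¬s' = ≈ₕ-trans (left-behind h∈ ¬s) (≈ₕ-sym (left-behind h'∈ ¬s'))

zipWith-tabulate : ∀ {A B C : Set} {n} (h : A → B → C) (f : Fin n → A) (g : Fin n → B) →
  V.zipWith h (V.tabulate f) (V.tabulate g) ≡ V.tabulate (λ i → h (f i) (g i))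
zipWith-tabulate {n = zero}  h f g = refl
zipWith-tabulate {n = suc n} h f g = cong (h (f Fin.zero) (g Fin.zero) ∷_) (zipWith-tabulate h (f ∘ Fin.suc) (g ∘ Fin.suc))

map-range : ∀ {A : Set} (f : ℕ → A) a m → L.map f (range a m) ≡ L.applyUpTo (λ i → f (a ℕ.+ i)) m
map-range f a m = trans (sym (LP.map-∘ (L.upTo m))) (LP.map-applyUpTo (λ i → i) _ m)

map-reverse-range : ∀ {A : Set} (f : ℕ → A) a m → L.map f (L.reverse (range a m)) ≡ L.applyDownFrom (λ i → f (a ℕ.+ i)) m
map-reverse-range f a m =
  trans (LP.reverse-map f (range a m)) (trans (cong L.reverse (map-range f a m)) (LP.reverse-applyUpTo _ m))

module Line (n₀ k₀ : ℕ) (k₀≤n₀ : k₀ ≤ n₀) where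

  n k c : ℕ
  n = suc n₀
  k = suc k₀
  c = n₀ ∸ k₀

  k≤n : k ≤ n
  k≤n = s≤s k₀≤n₀

  1≤k : 1 ≤ k
  1≤k = s≤s z≤n

  Dₙ : ℕ
  Dₙ = suc (4 ℕ.* n₀ ℕ.+ 1)

  D : ℤ
  D = + Dₙ

  Dₙ≡ : Dₙ ≡ suc (2 ℕ.* n₀) ℕ.+ suc (2 ℕ.* n₀)
  Dₙ≡ = double n₀
    where
    double : ∀ m → suc (4 ℕ.* m ℕ.+ 1) ≡ suc (2 ℕ.* m) ℕ.+ suc (2 ℕ.* m)
    double = NS.solve-∀

  D≡ : D ≡ + 4 ℤ.* + n₀ ℤ.+ + 2
  D≡ = trans (cong +_ (D-as-sum n₀)) (trans (ℤP.pos-+ (4 ℕ.* n₀) 2) (cong (ℤ._+ + 2) (ℤP.pos-* 4 n₀)))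
    where
    D-as-sum : ∀ m → suc (4 ℕ.* m ℕ.+ 1) ≡ 4 ℕ.* m ℕ.+ 2
    D-as-sum = NS.solve-∀

  r : ℚ
  r = mkℚ (+ 1) (4 ℕ.* n₀ ℕ.+ 1) (1-coprimeTo _)

  instance
    r-positive : ℚ.Positive r
    r-positive = _

  infix 7 _/D
  _/D : ℤ → ℚ
  a /D = toℚ a ℚ.* r

  toℚ≡/D : ∀ m → toℚ m ≡ (m ℤ.* D) /D
  toℚ≡/D m = sym (begin
    toℚ (m ℤ.* D) ℚ.* r       ≡⟨ cong (ℚ._* r) (toℚ-* m D) ⟩
    (toℚ m ℚ.* toℚ D) ℚ.* r   ≡⟨ ℚP.*-assoc (toℚ m) (toℚ D) r ⟩
    toℚ m ℚ.* (toℚ D ℚ.* r)   ≡⟨ cong (λ d → toℚ m ℚ.* (d ℚ.* r)) (toℚ≡ι D) ⟩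
    toℚ m ℚ.* (ι D ℚ.* r)     ≡⟨ cong (toℚ m ℚ.*_) (ℚP.*-inverseʳ (ι D)) ⟩
    toℚ m ℚ.* 1ℚ              ≡⟨ ℚP.*-identityʳ (toℚ m) ⟩
    toℚ m                     ∎)
    where open ≡-Reasoning

  /D-+ : ∀ a b → a /D ℚ.+ b /D ≡ (a ℤ.+ b) /D
  /D-+ a b = trans (sym (ℚP.*-distribʳ-+ r (toℚ a) (toℚ b))) (cong (ℚ._* r) (sym (toℚ-+ a b)))

  /D-neg : ∀ a → ℚ.- (a /D) ≡ (ℤ.- a) /D
  /D-neg a = trans (ℚP.neg-distribˡ-* (toℚ a) r) (cong (ℚ._* r) (sym (toℚ-neg a)))

  /D-- : ∀ a b → a /D ℚ.- b /D ≡ (a ℤ.- b) /D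
  /D-- a b = trans (cong (a /D ℚ.+_) (/D-neg b)) (/D-+ a (ℤ.- b))

  /D-mono-< : ∀ {a b} → a ℤ.< b → a /D ℚ.< b /D
  /D-mono-< a<b = ℚP.*-monoˡ-<-pos r (toℚ-mono-< a<b)

  /D-cancel-< : ∀ {a b} → a /D ℚ.< b /D → a ℤ.< b
  /D-cancel-< lt = toℚ-cancel-< (ℚP.*-cancelʳ-<-nonNeg r lt)

  /D-injective : ∀ {a b} → a /D ≡ b /D → a ≡ b
  /D-injective {a} {b} eq with ℤP.<-cmp a b
  ... | tri< a<b _ _ = ⊥-elim (ℚP.<-irrefl eq (/D-mono-< a<b))
  ... | tri≈ _ a≡b _ = a≡b
  ... | tri> _ _ b<a = ⊥-elim (ℚP.<-irrefl (sym eq) (/D-mono-< b<a))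

  -- Off position k the coordinates of the line are w p / D.  They decrease in steps of 2 and
  -- leave a gap of 4 around position k, in which the k-th coordinate u₀ / D of the start point
  -- lies.  The value w k = 0 serves only to make ρ Sign.- k = 0 for the long root 2ε_k.
  opaque
    w : ℕ → ℕ
    w p with ℕP.<-cmp p k
    ... | tri< _ _ _ = 2 ℕ.* (n ∸ p)
    ... | tri≈ _ _ _ = 0
    ... | tri> _ _ _ = 2 ℕ.* (suc n ∸ p)

  opaque
    unfolding w

    w-below : ∀ {p} → p ℕ.< k → w p ≡ 2 ℕ.* (n ∸ p)
    w-below {p} p<k with ℕP.<-cmp p k
    ... | tri< _ _ _    = refl
    ... | tri≈ ¬p<k _ _ = ⊥-elim (¬p<k p<k)
    ... | tri> ¬p<k _ _ = ⊥-elim (¬p<k p<k)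

    w-k : w k ≡ 0
    w-k with ℕP.<-cmp k k
    ... | tri< k<k _ _ = ⊥-elim (ℕP.<-irrefl refl k<k)
    ... | tri≈ _ _ _   = refl
    ... | tri> _ _ k<k = ⊥-elim (ℕP.<-irrefl refl k<k)

    w-above : ∀ {p} → k ℕ.< p → w p ≡ 2 ℕ.* (suc n ∸ p)
    w-above {p} k<p with ℕP.<-cmp p k
    ... | tri< _ _ ¬k<p = ⊥-elim (¬k<p k<p)
    ... | tri≈ _ _ ¬k<p = ⊥-elim (¬k<p k<p)
    ... | tri> _ _ _    = refl

    w-even : ∀ p → Σ ℕ λ h → w p ≡ 2 ℕ.* h
    w-even p with ℕP.<-cmp p k
    ... | tri< _ _ _ = n ∸ p , refl
    ... | tri≈ _ _ _ = 0 , refl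
    ... | tri> _ _ _ = suc n ∸ p , refl

  w-below-range : ∀ {p} → 1 ≤ p → p ℕ.< k → 2 ℕ.* suc c ≤ w p × w p ≤ 2 ℕ.* n₀
  w-below-range {p} 1≤p p<k rewrite w-below p<k =
    ℕP.*-monoʳ-≤ 2 (subst (ℕ._≤ n ∸ p) (ℕP.+-∸-assoc 1 k₀≤n₀) (ℕP.∸-monoʳ-≤ n (ℕ.s≤s⁻¹ p<k))) ,
    ℕP.*-monoʳ-≤ 2 (ℕP.∸-monoʳ-≤ n 1≤p)

  w-above-range : ∀ {p} → k ℕ.< p → p ≤ n → 2 ≤ w p × w p ≤ 2 ℕ.* c
  w-above-range {p} k<p p≤n rewrite w-above k<p =
    ℕP.*-monoʳ-≤ 2 (ℕP.m<n⇒0<n∸m (s≤s p≤n)) ,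
    ℕP.*-monoʳ-≤ 2 (ℕP.∸-monoʳ-≤ (suc n) k<p)

  w-below-decreasing : ∀ {p q} → p ℕ.< q → q ℕ.< k → w q ℕ.< w p
  w-below-decreasing p<q q<k rewrite w-below q<k | w-below (ℕP.<-trans p<q q<k) =
    ℕP.*-monoʳ-< 2 (ℕP.∸-monoʳ-< p<q (ℕP.<⇒≤ (ℕP.<-≤-trans q<k k≤n)))

  w-above-decreasing : ∀ {p q} → k ℕ.< p → p ℕ.< q → q ≤ n → w q ℕ.< w p
  w-above-decreasing k<p p<q q≤n rewrite w-above k<p | w-above (ℕP.<-trans k<p p<q) =
    ℕP.*-monoʳ-< 2 (ℕP.∸-monoʳ-< p<q (ℕP.m≤n⇒m≤1+n q≤n))

  w-≤ : ∀ {p} → 1 ≤ p → p ≤ n → w p ≤ 2 ℕ.* n₀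
  w-≤ {p} 1≤p p≤n with ℕP.<-cmp p k
  ... | tri< p<k _ _  = proj₂ (w-below-range 1≤p p<k)
  ... | tri≈ _ refl _ = subst (_≤ 2 ℕ.* n₀) (sym w-k) z≤n
  ... | tri> _ _ k<p  = ℕP.≤-trans (proj₂ (w-above-range k<p p≤n)) (ℕP.*-monoʳ-≤ 2 (ℕP.m∸n≤m n₀ k₀))

  w-positive : ∀ {p} → 1 ≤ p → p ≤ n → p ≢ k → 1 ≤ w p
  w-positive {p} 1≤p p≤n p≢k with ℕP.<-cmp p k
  ... | tri< p<k _ _  = ℕP.≤-trans (s≤s z≤n) (proj₁ (w-below-range 1≤p p<k))
  ... | tri≈ _ p≡k _  = ⊥-elim (p≢k p≡k)
  ... | tri> _ _ k<p  = ℕP.≤-trans (s≤s z≤n) (proj₁ (w-above-range k<p p≤n))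

  w-upper : ∀ i → i ℕ.< c → + w (suc k ℕ.+ i) ≡ + 2 ℤ.* (+ c ℤ.- + i)
  w-upper i i<c rewrite w-above {suc k ℕ.+ i} (s≤s (ℕP.m≤m+n k i)) = begin
    + (2 ℕ.* (n₀ ∸ (k₀ ℕ.+ i)))    ≡⟨ ℤP.pos-* 2 (n₀ ∸ (k₀ ℕ.+ i)) ⟩
    + 2 ℤ.* + (n₀ ∸ (k₀ ℕ.+ i))    ≡⟨ cong (λ m → + 2 ℤ.* + (m ∸ (k₀ ℕ.+ i))) (sym (ℕP.m+[n∸m]≡n k₀≤n₀)) ⟩
    + 2 ℤ.* + (k₀ ℕ.+ c ∸ (k₀ ℕ.+ i)) ≡⟨ cong (λ m → + 2 ℤ.* + m) (ℕP.[m+n]∸[m+o]≡n∸o k₀ c i) ⟩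
    + 2 ℤ.* + (c ∸ i)              ≡⟨ cong (+ 2 ℤ.*_) (+[a∸b] c i (ℕP.<⇒≤ i<c)) ⟩
    + 2 ℤ.* (+ c ℤ.- + i)          ∎
    where open ≡-Reasoning

  w-lower : ∀ q → q ℕ.< k₀ → + w (suc q) ≡ + 2 ℤ.* (+ n₀ ℤ.- + q)
  w-lower q q<k₀ rewrite w-below {suc q} (s≤s q<k₀) =
    trans (ℤP.pos-* 2 (n₀ ∸ q)) (cong (+ 2 ℤ.*_) (+[a∸b] n₀ q (ℕP.≤-trans (ℕP.<⇒≤ q<k₀) k₀≤n₀)))

  u₀ : ℤ
  u₀ = + 1 ℤ.+ + 2 ℤ.* + c

  z₀ : ℕ → ℕ
  z₀ p = if ⌊ p ℕ.≟ k ⌋ then suc (2 ℕ.* c) else w p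

  z₀-k : z₀ k ≡ suc (2 ℕ.* c)
  z₀-k with k ℕ.≟ k
  ... | yes _  = refl
  ... | no k≢k = ⊥-elim (k≢k refl)

  z₀-other : ∀ {p} → p ≢ k → z₀ p ≡ w p
  z₀-other {p} p≢k with p ℕ.≟ k
  ... | yes p≡k = ⊥-elim (p≢k p≡k)
  ... | no _    = refl

  2c<2[1+c] : 2 ℕ.* c ℕ.< 2 ℕ.* suc c
  2c<2[1+c] = ℕP.*-monoʳ-< 2 (ℕP.n<1+n c)

  1+2c<2[1+c] : suc (2 ℕ.* c) ℕ.< 2 ℕ.* suc c
  1+2c<2[1+c] = ℕP.≤-reflexive (sym (double-suc c))
    where
    double-suc : ∀ m → 2 ℕ.* suc m ≡ suc (suc (2 ℕ.* m))
    double-suc = NS.solve-∀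

  z₀-range : ∀ {p} → 1 ≤ p → p ≤ n → 1 ≤ z₀ p × z₀ p ≤ suc (2 ℕ.* n₀)
  z₀-range {p} 1≤p p≤n with ℕP.<-cmp p k
  ... | tri< p<k _ _ rewrite z₀-other (ℕP.<⇒≢ p<k) =
    ℕP.≤-trans (s≤s z≤n) (proj₁ (w-below-range 1≤p p<k)) , ℕP.m≤n⇒m≤1+n (proj₂ (w-below-range 1≤p p<k))
  ... | tri≈ _ refl _ rewrite z₀-k = s≤s z≤n , s≤s (ℕP.*-monoʳ-≤ 2 (ℕP.m∸n≤m n₀ k₀))
  ... | tri> _ _ k<p rewrite z₀-other (ℕP.>⇒≢ k<p) =
    ℕP.≤-trans (s≤s z≤n) (proj₁ (w-above-range k<p p≤n)) ,
    ℕP.m≤n⇒m≤1+n (ℕP.≤-trans (proj₂ (w-above-range k<p p≤n)) (ℕP.*-monoʳ-≤ 2 (ℕP.m∸n≤m n₀ k₀)))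

  z₀-decreasing : ∀ {p q} → 1 ≤ p → p ℕ.< q → q ≤ n → z₀ q ℕ.< z₀ p
  z₀-decreasing {p} {q} 1≤p p<q q≤n with ℕP.<-cmp p k | ℕP.<-cmp q k
  ... | tri< p<k _ _ | tri< q<k _ _ rewrite z₀-other (ℕP.<⇒≢ p<k) | z₀-other (ℕP.<⇒≢ q<k) =
    w-below-decreasing p<q q<k
  ... | tri< p<k _ _ | tri≈ _ refl _ rewrite z₀-other (ℕP.<⇒≢ p<k) | z₀-k =
    ℕP.<-≤-trans 1+2c<2[1+c] (proj₁ (w-below-range 1≤p p<k))
  ... | tri< p<k _ _ | tri> _ _ k<q rewrite z₀-other (ℕP.<⇒≢ p<k) | z₀-other (ℕP.>⇒≢ k<q) =
    ℕP.≤-<-trans (proj₂ (w-above-range k<q q≤n)) (ℕP.<-≤-trans 2c<2[1+c] (proj₁ (w-below-range 1≤p p<k)))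
  ... | tri≈ _ refl _ | tri< q<k _ _ = ⊥-elim (ℕP.<-asym p<q q<k)
  ... | tri≈ _ refl _ | tri≈ _ refl _ = ⊥-elim (ℕP.<-irrefl refl p<q)
  ... | tri≈ _ refl _ | tri> _ _ k<q rewrite z₀-k | z₀-other (ℕP.>⇒≢ k<q) =
    s≤s (proj₂ (w-above-range k<q q≤n))
  ... | tri> _ _ k<p | tri< q<k _ _ = ⊥-elim (ℕP.<-asym (ℕP.<-trans k<p p<q) q<k)
  ... | tri> _ _ k<p | tri≈ _ refl _ = ⊥-elim (ℕP.<-asym k<p p<q)
  ... | tri> _ _ k<p | tri> _ _ k<q rewrite z₀-other (ℕP.>⇒≢ k<p) | z₀-other (ℕP.>⇒≢ k<q) =
    w-above-decreasing k<p p<q q≤n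

  w-injective : ∀ {p q} → 1 ≤ p → p ≤ n → 1 ≤ q → q ≤ n → w p ≡ w q → p ≡ q
  w-injective {p} {q} 1≤p p≤n 1≤q q≤n eq with p ℕ.≟ k | q ℕ.≟ k
  ... | yes refl | yes refl = refl
  ... | yes refl | no q≢k   = ⊥-elim (ℕP.<⇒≢ (w-positive 1≤q q≤n q≢k) (sym (trans (sym eq) w-k)))
  ... | no p≢k   | yes refl = ⊥-elim (ℕP.<⇒≢ (w-positive 1≤p p≤n p≢k) (sym (trans eq w-k)))
  ... | no p≢k   | no q≢k with ℕP.<-cmp p q
  ...   | tri< p<q _ _ = ⊥-elim (ℕP.<⇒≢ (subst₂ ℕ._<_ (z₀-other q≢k) (z₀-other p≢k) (z₀-decreasing 1≤p p<q q≤n)) (sym eq))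
  ...   | tri≈ _ p≡q _ = p≡q
  ...   | tri> _ _ q<p = ⊥-elim (ℕP.<⇒≢ (subst₂ ℕ._<_ (z₀-other p≢k) (z₀-other q≢k) (z₀-decreasing 1≤q q<p p≤n)) eq)

  z : ℤ → ℕ → ℤ
  z u p = if ⌊ p ℕ.≟ k ⌋ then u else + w p

  R : ℤ → Pt n
  R u = V.tabulate (λ f → z u (suc (toℕ f)) /D)

  coord-R : ∀ u {p} → 1 ≤ p → p ≤ n → coord (R u) p ≡ z u p /D
  coord-R u {p} = coord-tabulate (λ q → z u q /D) p

  z-k : ∀ u → z u k ≡ u
  z-k u with k ℕ.≟ k
  ... | yes _  = refl
  ... | no k≢k = ⊥-elim (k≢k refl)

  z-other : ∀ u {p} → p ≢ k → z u p ≡ + w p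
  z-other u {p} p≢k with p ℕ.≟ k
  ... | yes p≡k = ⊥-elim (p≢k p≡k)
  ... | no _    = refl

  z-u₀ : ∀ p → z u₀ p ≡ + z₀ p
  z-u₀ p with p ℕ.≟ k
  ... | yes _ = cong (ℤ._+_ (+ 1)) (sym (ℤP.pos-* 2 c))
  ... | no _  = refl

  1ℚ≡D/D : 1ℚ ≡ D /D
  1ℚ≡D/D = trans (toℚ≡/D (+ 1)) (cong _/D (ℤP.*-identityˡ D))

  R-shift : ∀ u → R u +ₚ ptOf (ε k) ≡ R (u ℤ.+ D)
  R-shift u = begin
    V.zipWith ℚ._+_ (V.tabulate (λ f → z u (suc (toℕ f)) /D)) (V.map toℚ (V.tabulate δ))
      ≡⟨ cong (V.zipWith ℚ._+_ (R u)) (sym (tabulate-∘ toℚ δ)) ⟩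
    V.zipWith ℚ._+_ (V.tabulate (λ f → z u (suc (toℕ f)) /D)) (V.tabulate (toℚ ∘ δ))
      ≡⟨ zipWith-tabulate ℚ._+_ (λ f → z u (suc (toℕ f)) /D) (toℚ ∘ δ) ⟩
    V.tabulate (λ f → z u (suc (toℕ f)) /D ℚ.+ toℚ (δ f))
      ≡⟨ tabulate-cong (λ f → shift (suc (toℕ f))) ⟩
    R (u ℤ.+ D) ∎
    where
    open ≡-Reasoning
    δ : Fin n → ℤ
    δ f = if ⌊ suc (toℕ f) ℕ.≟ k ⌋ then + 1 else + 0
    shift : ∀ p → z u p /D ℚ.+ toℚ (if ⌊ p ℕ.≟ k ⌋ then + 1 else + 0) ≡ z (u ℤ.+ D) p /D
    shift p with p ℕ.≟ k
    ... | yes _ = trans (cong (u /D ℚ.+_) 1ℚ≡D/D) (/D-+ u D)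
    ... | no _  = ℚP.+-identityʳ (+ w p /D)

  start-in-A∘ : InA∘ (R u₀)
  start-in-A∘ = InA∘-intro (R u₀) positive below-1 decreasing sum-below-1
    where
    coord≡ : ∀ {p} → 1 ≤ p → p ≤ n → coord (R u₀) p ≡ + z₀ p /D
    coord≡ {p} 1≤p p≤n = trans (coord-R u₀ 1≤p p≤n) (cong _/D (z-u₀ p))
    0ℚ≡0/D : 0ℚ ≡ + 0 /D
    0ℚ≡0/D = sym (ℚP.*-zeroˡ r)
    z₀<D : ∀ {p} → 1 ≤ p → p ≤ n → z₀ p ℕ.< Dₙ
    z₀<D 1≤p p≤n = ℕP.≤-<-trans (proj₂ (z₀-range 1≤p p≤n))
                        (subst (suc (2 ℕ.* n₀) ℕ.<_) (sym Dₙ≡) (ℕP.m<m+n (suc (2 ℕ.* n₀)) (s≤s z≤n)))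
    positive : ∀ p → 1 ≤ p → p ≤ n → 0ℚ ℚ.< coord (R u₀) p
    positive p 1≤p p≤n =
      subst₂ ℚ._<_ (sym 0ℚ≡0/D) (sym (coord≡ 1≤p p≤n)) (/D-mono-< (ℤ.+<+ (proj₁ (z₀-range 1≤p p≤n))))
    below-1 : ∀ p → 1 ≤ p → p ≤ n → coord (R u₀) p ℚ.< 1ℚ
    below-1 p 1≤p p≤n = subst₂ ℚ._<_ (sym (coord≡ 1≤p p≤n)) (sym 1ℚ≡D/D) (/D-mono-< (ℤ.+<+ (z₀<D 1≤p p≤n)))
    decreasing : ∀ p q → 1 ≤ p → p ℕ.< q → q ≤ n → coord (R u₀) q ℚ.< coord (R u₀) p
    decreasing p q 1≤p p<q q≤n = subst₂ ℚ._<_ (sym (coord≡ (ℕP.≤-trans 1≤p (ℕP.<⇒≤ p<q)) q≤n))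
      (sym (coord≡ 1≤p (ℕP.<⇒≤ (ℕP.<-≤-trans p<q q≤n)))) (/D-mono-< (ℤ.+<+ (z₀-decreasing 1≤p p<q q≤n)))
    sum-below-1 : ∀ p q → 1 ≤ p → p ℕ.< q → q ≤ n → coord (R u₀) p ℚ.+ coord (R u₀) q ℚ.< 1ℚ
    sum-below-1 p q 1≤p p<q q≤n = begin-strict
      coord (R u₀) p ℚ.+ coord (R u₀) q   ≡⟨ cong₂ ℚ._+_ (coord≡ 1≤p p≤n) (coord≡ 1≤q q≤n) ⟩
      + z₀ p /D ℚ.+ + z₀ q /D       ≡⟨ /D-+ (+ z₀ p) (+ z₀ q) ⟩
      (+ z₀ p ℤ.+ + z₀ q) /D         <⟨ /D-mono-< (ℤ.+<+ sum<D) ⟩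
      D /D                                 ≡⟨ sym 1ℚ≡D/D ⟩
      1ℚ                                   ∎
      where
      open ℚP.≤-Reasoning
      p≤n = ℕP.<⇒≤ (ℕP.<-≤-trans p<q q≤n)
      1≤q = ℕP.≤-trans 1≤p (ℕP.<⇒≤ p<q)
      sum<D : z₀ p ℕ.+ z₀ q ℕ.< Dₙ
      sum<D = ℕP.<-≤-trans (ℕP.+-monoʳ-< (z₀ p) (z₀-decreasing 1≤p p<q q≤n))
                (subst (z₀ p ℕ.+ z₀ p ℕ.≤_) (sym Dₙ≡)
                  (ℕP.+-mono-≤ (proj₂ (z₀-range 1≤p p≤n)) (proj₂ (z₀-range 1≤p p≤n))))

  coord-R-k : ∀ u → coord (R u) k ≡ u /D
  coord-R-k u = trans (coord-R u 1≤k k≤n) (cong _/D (z-k u))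

  coord-R-other : ∀ u {p} → 1 ≤ p → p ≤ n → p ≢ k → coord (R u) p ≡ + w p /D
  coord-R-other u 1≤p p≤n p≢k = trans (coord-R u 1≤p p≤n) (cong _/D (z-other u p≢k))

  -- The walls met by the line

  ρ : Sign → ℕ → ℤ
  ρ σ p = σ ◃ w p

  -- KRoot σ p indexes the roots ε_k − σ ε_p (and 2ε_k for p = k) occurring in Γ, kr κ being
  -- the root as it is written there.
  data KRoot : Sign → ℕ → Set where
    upper⁻ : ∀ {p} → k ℕ.< p → p ≤ n → KRoot Sign.+ p
    upper⁺ : ∀ {p} → k ℕ.< p → p ≤ n → KRoot Sign.- p
    long   : KRoot Sign.- k
    lower⁺ : ∀ {p} → 1 ≤ p → p ℕ.< k → KRoot Sign.- p
    lower⁻ : ∀ {p} → 1 ≤ p → p ℕ.< k → KRoot Sign.+ p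

  kr : ∀ {σ p} → KRoot σ p → Wt n
  kr (upper⁻ {p} _ _) = ⟨ k , p ⟩⁻
  kr (upper⁺ {p} _ _) = ⟨ k , p ⟩⁺
  kr long             = ⟨ k , k ⟩⁺
  kr (lower⁺ {p} _ _) = ⟨ p , k ⟩⁺
  kr (lower⁻ {p} _ _) = ⊖ ⟨ p , k ⟩⁻

  level : ∀ {σ p} → KRoot σ p → ℤ
  level (lower⁻ _ _) = ℤ.- + 1
  level _            = + 0

  coroot-kr : ∀ {σ p} (κ : KRoot σ p) u → coroot⟨ R u , kr κ ⟩ ≡ (u ℤ.- ρ σ p) /D
  coroot-kr (upper⁻ {p} k<p p≤n) u = begin
    coroot⟨ R u , ⟨ k , p ⟩⁻ ⟩      ≡⟨ coroot-coord (R u) (short⁻ 1≤k k<p p≤n) ⟩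
    coord (R u) k ℚ.- coord (R u) p ≡⟨ cong₂ ℚ._-_ (coord-R-k u) (coord-R-other u (ℕP.≤-trans 1≤k (ℕP.<⇒≤ k<p)) p≤n (ℕP.>⇒≢ k<p)) ⟩
    u /D ℚ.- + w p /D               ≡⟨ /D-- u (+ w p) ⟩
    (u ℤ.- + w p) /D                ≡⟨ cong (λ a → (u ℤ.- a) /D) (sym (ℤP.+◃n≡+n (w p))) ⟩
    (u ℤ.- ρ Sign.+ p) /D           ∎
    where open ≡-Reasoning
  coroot-kr (upper⁺ {p} k<p p≤n) u = begin
    coroot⟨ R u , ⟨ k , p ⟩⁺ ⟩      ≡⟨ coroot-coord (R u) (short⁺ 1≤k k<p p≤n) ⟩
    coord (R u) k ℚ.+ coord (R u) p ≡⟨ cong₂ ℚ._+_ (coord-R-k u) (coord-R-other u (ℕP.≤-trans 1≤k (ℕP.<⇒≤ k<p)) p≤n (ℕP.>⇒≢ k<p)) ⟩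
    u /D ℚ.+ + w p /D               ≡⟨ /D-+ u (+ w p) ⟩
    (u ℤ.+ + w p) /D                ≡⟨ cong (λ a → (u ℤ.+ a) /D) (sym (ℤP.neg-involutive (+ w p))) ⟩
    (u ℤ.- (ℤ.- + w p)) /D          ≡⟨ cong (λ a → (u ℤ.- a) /D) (sym (ℤP.-◃n≡-n (w p))) ⟩
    (u ℤ.- ρ Sign.- p) /D           ∎
    where open ≡-Reasoning
  coroot-kr long u = begin
    coroot⟨ R u , ⟨ k , k ⟩⁺ ⟩ ≡⟨ coroot-coord (R u) (long 1≤k k≤n) ⟩
    coord (R u) k              ≡⟨ coord-R-k u ⟩
    u /D                       ≡⟨ cong _/D (sym (ℤP.+-identityʳ u)) ⟩
    (u ℤ.- + 0) /D             ≡⟨ cong (λ m → (u ℤ.- (Sign.- ◃ m)) /D) (sym w-k) ⟩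
    (u ℤ.- ρ Sign.- k) /D      ∎
    where open ≡-Reasoning
  coroot-kr (lower⁺ {p} 1≤p p<k) u = begin
    coroot⟨ R u , ⟨ p , k ⟩⁺ ⟩      ≡⟨ coroot-coord (R u) (short⁺ 1≤p p<k k≤n) ⟩
    coord (R u) p ℚ.+ coord (R u) k ≡⟨ cong₂ ℚ._+_ (coord-R-other u 1≤p (ℕP.<⇒≤ (ℕP.<-≤-trans p<k k≤n)) (ℕP.<⇒≢ p<k)) (coord-R-k u) ⟩
    + w p /D ℚ.+ u /D               ≡⟨ /D-+ (+ w p) u ⟩
    (+ w p ℤ.+ u) /D                ≡⟨ cong _/D (rearrange (+ w p) u) ⟩
    (u ℤ.- (ℤ.- + w p)) /D          ≡⟨ cong (λ a → (u ℤ.- a) /D) (sym (ℤP.-◃n≡-n (w p))) ⟩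
    (u ℤ.- ρ Sign.- p) /D           ∎
    where
    open ≡-Reasoning
    rearrange : ∀ a u → a ℤ.+ u ≡ u ℤ.- (ℤ.- a)
    rearrange = solve-∀
  coroot-kr (lower⁻ {p} 1≤p p<k) u = begin
    coroot⟨ R u , ⊖ ⟨ p , k ⟩⁻ ⟩              ≡⟨ coroot-⊖ (R u) ⟨ p , k ⟩⁻ ⟩
    ℚ.- coroot⟨ R u , ⟨ p , k ⟩⁻ ⟩            ≡⟨ cong ℚ.-_ (coroot-coord (R u) (short⁻ 1≤p p<k k≤n)) ⟩
    ℚ.- (coord (R u) p ℚ.- coord (R u) k)     ≡⟨ cong (λ a → ℚ.- (a ℚ.- coord (R u) k)) (coord-R-other u 1≤p (ℕP.<⇒≤ (ℕP.<-≤-trans p<k k≤n)) (ℕP.<⇒≢ p<k)) ⟩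
    ℚ.- (+ w p /D ℚ.- coord (R u) k)          ≡⟨ cong (λ a → ℚ.- (+ w p /D ℚ.- a)) (coord-R-k u) ⟩
    ℚ.- (+ w p /D ℚ.- u /D)                   ≡⟨ trans (cong ℚ.-_ (/D-- (+ w p) u)) (/D-neg (+ w p ℤ.- u)) ⟩
    (ℤ.- (+ w p ℤ.- u)) /D                    ≡⟨ cong _/D (rearrange (+ w p) u) ⟩
    (u ℤ.- + w p) /D                          ≡⟨ cong (λ a → (u ℤ.- a) /D) (sym (ℤP.+◃n≡+n (w p))) ⟩
    (u ℤ.- ρ Sign.+ p) /D                     ∎
    where
    open ≡-Reasoning
    rearrange : ∀ a u → ℤ.- (a ℤ.- u) ≡ u ℤ.- a
    rearrange = solve-∀

  coroot-ε-kr : ∀ {σ p} (κ : KRoot σ p) → coroot⟨ ptOf (ε k) , kr κ ⟩ ≡ 1ℚ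
  coroot-ε-kr {σ} {p} κ = begin
    x                                        ≡⟨ solve 2 (λ a x → x := (a :+ x) :- a) refl a x ⟩
    (a ℚ.+ x) ℚ.- a                          ≡⟨ cong (ℚ._- a) (sym (coroot-+ₚ (R (+ 0)) (ptOf (ε k)) (kr κ))) ⟩
    coroot⟨ R (+ 0) +ₚ ptOf (ε k) , kr κ ⟩ ℚ.- a ≡⟨ cong (λ ξ → coroot⟨ ξ , kr κ ⟩ ℚ.- a) (R-shift (+ 0)) ⟩
    coroot⟨ R (+ 0 ℤ.+ D) , kr κ ⟩ ℚ.- a     ≡⟨ cong₂ ℚ._-_ (coroot-kr κ (+ 0 ℤ.+ D)) (coroot-kr κ (+ 0)) ⟩
    (+ 0 ℤ.+ D ℤ.- ρ σ p) /D ℚ.- (+ 0 ℤ.- ρ σ p) /D ≡⟨ /D-- (+ 0 ℤ.+ D ℤ.- ρ σ p) (+ 0 ℤ.- ρ σ p) ⟩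
    ((+ 0 ℤ.+ D ℤ.- ρ σ p) ℤ.- (+ 0 ℤ.- ρ σ p)) /D  ≡⟨ cong _/D (difference D (ρ σ p)) ⟩
    D /D                                     ≡⟨ sym 1ℚ≡D/D ⟩
    1ℚ                                       ∎
    where
    open ≡-Reasoning
    a x : ℚ
    a = coroot⟨ R (+ 0) , kr κ ⟩
    x = coroot⟨ ptOf (ε k) , kr κ ⟩
    difference : ∀ d r → (+ 0 ℤ.+ d ℤ.- r) ℤ.- (+ 0 ℤ.- r) ≡ d
    difference = solve-∀

  coroot-kr-shift : ∀ {σ p} (κ : KRoot σ p) η → coroot⟨ η +ₚ ptOf (ε k) , kr κ ⟩ ≡ coroot⟨ η , kr κ ⟩ ℚ.+ 1ℚ
  coroot-kr-shift κ η = trans (coroot-+ₚ η (ptOf (ε k)) (kr κ)) (cong (coroot⟨ η , kr κ ⟩ ℚ.+_) (coroot-ε-kr κ))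

  kr-sign : ∀ {σ p} (κ : KRoot σ p) →
    (IsPosRoot n (kr κ) × level κ ≡ + 0) ⊎ (IsPosRoot n (⊖ kr κ) × level κ ≡ ℤ.- + 1)
  kr-sign (upper⁻ k<p p≤n) = inj₁ (short⁻ 1≤k k<p p≤n , refl)
  kr-sign (upper⁺ k<p p≤n) = inj₁ (short⁺ 1≤k k<p p≤n , refl)
  kr-sign long             = inj₁ (long 1≤k k≤n , refl)
  kr-sign (lower⁺ 1≤p p<k) = inj₁ (short⁺ 1≤p p<k k≤n , refl)
  kr-sign (lower⁻ 1≤p p<k) = inj₂ (subst (IsPosRoot n) (sym (⊖-involutive _)) (short⁻ 1≤p p<k k≤n) , refl)

  kr-root : ∀ {σ p} (κ : KRoot σ p) → IsRoot n (kr κ)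
  kr-root κ = Sum.map proj₁ proj₁ (kr-sign κ)

  kr-in-A∘ : ∀ {ξ σ p} → InA∘ ξ → (κ : KRoot σ p) →
    toℚ (level κ) ℚ.< coroot⟨ ξ , kr κ ⟩ × coroot⟨ ξ , kr κ ⟩ ℚ.< toℚ (level κ) ℚ.+ 1ℚ
  kr-in-A∘ {ξ} ξ∈A∘ κ with kr-sign κ
  ... | inj₁ (positive , ℓ≡0) rewrite ℓ≡0 = ξ∈A∘ (kr κ) positive
  ... | inj₂ (negative , ℓ≡-1) rewrite ℓ≡-1 =
    neg-cancel-< {b = toℚ (ℤ.- + 1)} (subst (ℚ._< 1ℚ) (coroot-⊖ ξ (kr κ)) (proj₂ (ξ∈A∘ (⊖ kr κ) negative))) ,
    neg-cancel-< {a = 0ℚ} (subst (0ℚ ℚ.<_) (coroot-⊖ ξ (kr κ)) (proj₁ (ξ∈A∘ (⊖ kr κ) negative)))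

  wall-separates : ∀ {ξ η σ p} → InA∘ ξ → InA∘ (η +ₚ ptOf (ε k)) → (κ : KRoot σ p) →
                   Separated ξ η (kr κ , level κ)
  wall-separates {ξ} {η} ξ∈A∘ η+ε∈A∘ κ = inj₂ (η-below , proj₁ (kr-in-A∘ {ξ} ξ∈A∘ κ))
    where
    η-below : coroot⟨ η , kr κ ⟩ ℚ.< toℚ (level κ)
    η-below = subst₂ ℚ._<_ (cancel (coroot⟨ η , kr κ ⟩)) (cancel (toℚ (level κ))) (ℚP.+-monoˡ-< (ℚ.- 1ℚ)
                (subst (ℚ._< toℚ (level κ) ℚ.+ 1ℚ) (coroot-kr-shift κ η) (proj₂ (kr-in-A∘ {η +ₚ ptOf (ε k)} η+ε∈A∘ κ))))
      where
      cancel : ∀ a → a ℚ.+ 1ℚ ℚ.- 1ℚ ≡ a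
      cancel = solve 1 (λ a → a :+ con 1ℚ :- con 1ℚ := a) refl

  KRoot-valid : ∀ {σ p} → KRoot σ p → 1 ≤ p × p ≤ n
  KRoot-valid (upper⁻ k<p p≤n) = ℕP.≤-trans 1≤k (ℕP.<⇒≤ k<p) , p≤n
  KRoot-valid (upper⁺ k<p p≤n) = ℕP.≤-trans 1≤k (ℕP.<⇒≤ k<p) , p≤n
  KRoot-valid long             = 1≤k , k≤n
  KRoot-valid (lower⁺ 1≤p p<k) = 1≤p , ℕP.<⇒≤ (ℕP.<-≤-trans p<k k≤n)
  KRoot-valid (lower⁻ 1≤p p<k) = 1≤p , ℕP.<⇒≤ (ℕP.<-≤-trans p<k k≤n)

  KRoot-k : ∀ {σ} → KRoot σ k → σ ≡ Sign.-
  KRoot-k (upper⁻ k<k _) = ⊥-elim (ℕP.<-irrefl refl k<k)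
  KRoot-k (upper⁺ k<k _) = ⊥-elim (ℕP.<-irrefl refl k<k)
  KRoot-k long           = refl
  KRoot-k (lower⁺ _ k<k) = ⊥-elim (ℕP.<-irrefl refl k<k)
  KRoot-k (lower⁻ _ k<k) = ⊥-elim (ℕP.<-irrefl refl k<k)

  kr-irrelevant : ∀ {σ p} (κ κ' : KRoot σ p) → kr κ ≡ kr κ'
  kr-irrelevant (upper⁻ _ _)   (upper⁻ _ _)   = refl
  kr-irrelevant (upper⁻ k<p _) (lower⁻ _ p<k) = ⊥-elim (ℕP.<-asym k<p p<k)
  kr-irrelevant (upper⁺ _ _)   (upper⁺ _ _)   = refl
  kr-irrelevant (upper⁺ k<k _) long           = ⊥-elim (ℕP.<-irrefl refl k<k)
  kr-irrelevant (upper⁺ k<p _) (lower⁺ _ p<k) = ⊥-elim (ℕP.<-asym k<p p<k)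
  kr-irrelevant long           (upper⁺ k<k _) = ⊥-elim (ℕP.<-irrefl refl k<k)
  kr-irrelevant long           long           = refl
  kr-irrelevant long           (lower⁺ _ k<k) = ⊥-elim (ℕP.<-irrefl refl k<k)
  kr-irrelevant (lower⁺ _ p<k) (upper⁺ k<p _) = ⊥-elim (ℕP.<-asym k<p p<k)
  kr-irrelevant (lower⁺ _ k<k) long           = ⊥-elim (ℕP.<-irrefl refl k<k)
  kr-irrelevant (lower⁺ _ _)   (lower⁺ _ _)   = refl
  kr-irrelevant (lower⁻ _ p<k) (upper⁻ k<p _) = ⊥-elim (ℕP.<-asym k<p p<k)
  kr-irrelevant (lower⁻ _ _)   (lower⁻ _ _)   = refl

  ρ-injective : ∀ {σ σ' p q} → KRoot σ p → KRoot σ' q → ρ σ p ≡ ρ σ' q → σ ≡ σ' × p ≡ q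
  ρ-injective {σ} {σ'} {p} {q} κ κ' ρ≡ρ' = σ≡σ' , p≡q
    where
    1≤p = proj₁ (KRoot-valid κ)
    p≤n = proj₂ (KRoot-valid κ)
    p≡q : p ≡ q
    p≡q = w-injective 1≤p p≤n (proj₁ (KRoot-valid κ')) (proj₂ (KRoot-valid κ'))
            (trans (sym (ℤP.abs-◃ σ (w p))) (trans (cong ℤ.∣_∣ ρ≡ρ') (ℤP.abs-◃ σ' (w q))))
    σ≡σ' : σ ≡ σ'
    σ≡σ' with p ℕ.≟ k
    ... | yes refl = trans (KRoot-k κ) (sym (KRoot-k (subst (KRoot σ') (sym p≡q) κ')))
    ... | no p≢k   = begin
      σ                     ≡⟨ sym (ℤP.sign-◃ σ (w p) {{w≢0}}) ⟩
      ℤ.sign (σ ◃ w p)      ≡⟨ cong ℤ.sign (trans ρ≡ρ' (cong (λ m → σ' ◃ w m) (sym p≡q))) ⟩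
      ℤ.sign (σ' ◃ w p)     ≡⟨ ℤP.sign-◃ σ' (w p) {{w≢0}} ⟩
      σ'                    ∎
      where
      open ≡-Reasoning
      w≢0 = ℕ.>-nonZero (w-positive 1≤p p≤n p≢k)

  kr-injective : ∀ {σ σ' p q} (κ : KRoot σ p) (κ' : KRoot σ' q) → ρ σ p ≡ ρ σ' q → kr κ ≡ kr κ'
  kr-injective κ κ' ρ≡ρ' with ρ-injective κ κ' ρ≡ρ'
  ... | refl , refl = kr-irrelevant κ κ'

  ρ-bound : ∀ {σ p} → KRoot σ p → ℤ.∣ ρ σ p ∣ ≤ 2 ℕ.* n₀
  ρ-bound {σ} {p} κ = subst (_≤ 2 ℕ.* n₀) (sym (ℤP.abs-◃ σ (w p))) (w-≤ (proj₁ (KRoot-valid κ)) (proj₂ (KRoot-valid κ)))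

  -- Two walls crossed at the same parameter coincide: their offsets differ by a multiple of D
  -- but by less than D.
  same-crossing : ∀ {v σ σ' p q ℓ ℓ'} → KRoot σ p → KRoot σ' q →
    v ℤ.- ρ σ p ≡ ℓ ℤ.* D → v ℤ.- ρ σ' q ≡ ℓ' ℤ.* D → ρ σ p ≡ ρ σ' q × ℓ ≡ ℓ'
  same-crossing {v} {σ} {σ'} {p} {q} {ℓ} {ℓ'} κ κ' at at' =
    sym (≡-from-difference (ρ σ' q) (ρ σ p) (trans difference (trans (cong (ℤ._* D) ℓ-ℓ'≡0) (ℤP.*-zeroˡ D)))) ,
    ≡-from-difference ℓ ℓ' ℓ-ℓ'≡0
    where
    difference : ρ σ' q ℤ.- ρ σ p ≡ (ℓ ℤ.- ℓ') ℤ.* D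
    difference = begin
      ρ σ' q ℤ.- ρ σ p                     ≡⟨ rearrange v (ρ σ p) (ρ σ' q) ⟩
      (v ℤ.- ρ σ p) ℤ.- (v ℤ.- ρ σ' q)     ≡⟨ cong₂ ℤ._-_ at at' ⟩
      ℓ ℤ.* D ℤ.- ℓ' ℤ.* D                 ≡⟨ factor ℓ ℓ' D ⟩
      (ℓ ℤ.- ℓ') ℤ.* D                     ∎
      where
      open ≡-Reasoning
      rearrange : ∀ v r r' → r' ℤ.- r ≡ (v ℤ.- r) ℤ.- (v ℤ.- r')
      rearrange = solve-∀
      factor : ∀ a b d → a ℤ.* d ℤ.- b ℤ.* d ≡ (a ℤ.- b) ℤ.* d
      factor = solve-∀
    small : ℤ.∣ ρ σ' q ℤ.- ρ σ p ∣ ℕ.< Dₙ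
    small = ℕP.≤-<-trans (ℤP.∣i-j∣≤∣i∣+∣j∣ (ρ σ' q) (ρ σ p))
              (ℕP.≤-<-trans (ℕP.+-mono-≤ (ρ-bound κ') (ρ-bound κ))
                (subst (2 ℕ.* n₀ ℕ.+ 2 ℕ.* n₀ ℕ.<_) (sym Dₙ≡) (ℕP.+-mono-< (ℕP.n<1+n _) (ℕP.n<1+n _))))
    ℓ-ℓ'≡0 : ℓ ℤ.- ℓ' ≡ + 0
    ℓ-ℓ'≡0 = small-multiple _ _ small difference

  unmoved : ∀ u {p} → 1 ≤ p → p ≤ n → p ≢ k → coord (R u) p ≡ coord (R u₀) p
  unmoved u 1≤p p≤n p≢k = trans (coord-R-other u 1≤p p≤n p≢k) (sym (coord-R-other u₀ 1≤p p≤n p≢k))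

  data Along (α : Wt n) : Set where
    fixed  : (∀ u → coroot⟨ R u , α ⟩ ≡ coroot⟨ R u₀ , α ⟩) → Along α
    moving : ∀ {σ p} (κ : KRoot σ p) → α ≡ kr κ ⊎ α ≡ ⊖ kr κ → Along α

  along : ∀ {α} → IsPosRoot n α → Along α
  along pr@(short⁻ {i} {j} 1≤i i<j j≤n) with i ℕ.≟ k | j ℕ.≟ k
  ... | yes refl | _        = moving (upper⁻ i<j j≤n) (inj₁ refl)
  ... | no _     | yes refl = moving (lower⁻ 1≤i i<j) (inj₂ (sym (⊖-involutive _)))
  ... | no i≢k   | no j≢k   = fixed λ u →
    trans (coroot-coord (R u) pr) (trans (cong₂ ℚ._-_ (unmoved u 1≤i i≤n i≢k) (unmoved u 1≤j j≤n j≢k))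
                                         (sym (coroot-coord (R u₀) pr)))
    where
    i≤n = ℕP.<⇒≤ (ℕP.<-≤-trans i<j j≤n)
    1≤j = ℕP.≤-trans 1≤i (ℕP.<⇒≤ i<j)
  along pr@(short⁺ {i} {j} 1≤i i<j j≤n) with i ℕ.≟ k | j ℕ.≟ k
  ... | yes refl | _        = moving (upper⁺ i<j j≤n) (inj₁ refl)
  ... | no _     | yes refl = moving (lower⁺ 1≤i i<j) (inj₁ refl)
  ... | no i≢k   | no j≢k   = fixed λ u →
    trans (coroot-coord (R u) pr) (trans (cong₂ ℚ._+_ (unmoved u 1≤i i≤n i≢k) (unmoved u 1≤j j≤n j≢k))
                                         (sym (coroot-coord (R u₀) pr)))
    where
    i≤n = ℕP.<⇒≤ (ℕP.<-≤-trans i<j j≤n)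
    1≤j = ℕP.≤-trans 1≤i (ℕP.<⇒≤ i<j)
  along pr@(long {i} 1≤i i≤n) with i ℕ.≟ k
  ... | yes refl = moving long (inj₁ refl)
  ... | no i≢k   = fixed λ u →
    trans (coroot-coord (R u) pr) (trans (unmoved u 1≤i i≤n i≢k) (sym (coroot-coord (R u₀) pr)))

  ρ-even : ∀ σ p → Σ ℤ λ h → ρ σ p ≡ + 2 ℤ.* h
  ρ-even Sign.+ p with w-even p
  ... | h , w≡2h = + h , trans (ℤP.+◃n≡+n (w p)) (trans (cong +_ w≡2h) (ℤP.pos-* 2 h))
  ρ-even Sign.- p with w-even p
  ... | h , w≡2h = ℤ.- + h , trans (ℤP.-◃n≡-n (w p))
                     (trans (cong (λ m → ℤ.- + m) w≡2h) (trans (cong ℤ.-_ (ℤP.pos-* 2 h)) (ℤP.neg-distribʳ-* (+ 2) (+ h))))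

  D-even : D ≡ + 2 ℤ.* (+ 2 ℤ.* + n₀ ℤ.+ + 1)
  D-even = trans D≡ (halve (+ n₀))
    where
    halve : ∀ m → + 4 ℤ.* m ℤ.+ + 2 ≡ + 2 ℤ.* (+ 2 ℤ.* m ℤ.+ + 1)
    halve = solve-∀

  odd-off-walls : ∀ t {σ p} ℓ → (+ 1 ℤ.+ + 2 ℤ.* t) ℤ.- ρ σ p ≢ ℓ ℤ.* D
  odd-off-walls t {σ} {p} ℓ on with ρ-even σ p
  ... | h , ρ≡2h = odd≢even (t ℤ.- h) (ℓ ℤ.* (+ 2 ℤ.* + n₀ ℤ.+ + 1)) (begin
    + 1 ℤ.+ + 2 ℤ.* (t ℤ.- h)             ≡⟨ regroup t h ⟩
    (+ 1 ℤ.+ + 2 ℤ.* t) ℤ.- + 2 ℤ.* h     ≡⟨ cong (ℤ._-_ (+ 1 ℤ.+ + 2 ℤ.* t)) (sym ρ≡2h) ⟩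
    (+ 1 ℤ.+ + 2 ℤ.* t) ℤ.- ρ σ p         ≡⟨ on ⟩
    ℓ ℤ.* D                               ≡⟨ cong (ℓ ℤ.*_) D-even ⟩
    ℓ ℤ.* (+ 2 ℤ.* (+ 2 ℤ.* + n₀ ℤ.+ + 1)) ≡⟨ swap ℓ (+ 2 ℤ.* + n₀ ℤ.+ + 1) ⟩
    + 2 ℤ.* (ℓ ℤ.* (+ 2 ℤ.* + n₀ ℤ.+ + 1)) ∎)
    where
    open ≡-Reasoning
    regroup : ∀ t h → + 1 ℤ.+ + 2 ℤ.* (t ℤ.- h) ≡ (+ 1 ℤ.+ + 2 ℤ.* t) ℤ.- + 2 ℤ.* h
    regroup = solve-∀
    swap : ∀ a b → a ℤ.* (+ 2 ℤ.* b) ≡ + 2 ℤ.* (a ℤ.* b)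
    swap = solve-∀

  -- A coroot along the line either keeps its value at the start point, which lies in (0, 1),
  -- or is ± (u − ρ σ p) / D, where u is odd while ρ σ p and D are even.
  R-generic : ∀ t → Generic (R (+ 1 ℤ.+ + 2 ℤ.* t))
  R-generic t α pr l on with along pr
  ... | fixed unmoved-α =
    no-integer-in-unit-interval l (subst (0ℚ ℚ.<_) on′ (proj₁ (start-in-A∘ α pr))) (subst (ℚ._< 1ℚ) on′ (proj₂ (start-in-A∘ α pr)))
    where
    on′ = trans (sym (unmoved-α (+ 1 ℤ.+ + 2 ℤ.* t))) on
  ... | moving κ ± with ≈ₕ-of-± ± l
  ...   | ℓ , ≈kr = odd-off-walls t ℓ
    (/D-injective (trans (sym (coroot-kr κ (+ 1 ℤ.+ + 2 ℤ.* t))) (trans (on-≈ₕ {ξ = R (+ 1 ℤ.+ + 2 ℤ.* t)} ≈kr on) (toℚ≡/D ℓ))))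

  coroot-kr-beside : ∀ {σ p} (κ : KRoot σ p) v →
    coroot⟨ R (v ℤ.+ + 1) , kr κ ⟩ ≡ ((v ℤ.- ρ σ p) ℤ.+ + 1) /D ×
    coroot⟨ R (v ℤ.- + 1) , kr κ ⟩ ≡ ((v ℤ.- ρ σ p) ℤ.- + 1) /D
  coroot-kr-beside {σ} {p} κ v =
    trans (coroot-kr κ (v ℤ.+ + 1)) (cong _/D (above v (ρ σ p))) ,
    trans (coroot-kr κ (v ℤ.- + 1)) (cong _/D (below v (ρ σ p)))
    where
    above : ∀ v r → (v ℤ.+ + 1) ℤ.- r ≡ (v ℤ.- r) ℤ.+ + 1
    above = solve-∀
    below : ∀ v r → (v ℤ.- + 1) ℤ.- r ≡ (v ℤ.- r) ℤ.- + 1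
    below = solve-∀

  line-crossing : ∀ {v σ p ℓ} (κ : KRoot σ p) →
    Separated (R (v ℤ.+ + 1)) (R (v ℤ.- + 1)) (kr κ , ℓ) → v ℤ.- ρ σ p ≡ ℓ ℤ.* D
  line-crossing {v} {σ} {p} {ℓ} κ (inj₁ (before , after)) =
    ⊥-elim (ℤP.<-asym (ℤP.<-trans (below-ℓ before) (above-ℓ after)) (ℤP.<-trans (i-1<i (v ℤ.- ρ σ p)) (i<i+1 (v ℤ.- ρ σ p))))
    where
    below-ℓ : coroot⟨ R (v ℤ.+ + 1) , kr κ ⟩ ℚ.< toℚ ℓ → (v ℤ.- ρ σ p) ℤ.+ + 1 ℤ.< ℓ ℤ.* D
    below-ℓ lt = /D-cancel-< (subst₂ ℚ._<_ (proj₁ (coroot-kr-beside κ v)) (toℚ≡/D ℓ) lt)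
    above-ℓ : toℚ ℓ ℚ.< coroot⟨ R (v ℤ.- + 1) , kr κ ⟩ → ℓ ℤ.* D ℤ.< (v ℤ.- ρ σ p) ℤ.- + 1
    above-ℓ lt = /D-cancel-< (subst₂ ℚ._<_ (toℚ≡/D ℓ) (proj₂ (coroot-kr-beside κ v)) lt)
  line-crossing {v} {σ} {p} {ℓ} κ (inj₂ (before , after)) = sym (squeeze
    (/D-cancel-< (subst₂ ℚ._<_ (proj₂ (coroot-kr-beside κ v)) (toℚ≡/D ℓ) before))
    (/D-cancel-< (subst₂ ℚ._<_ (toℚ≡/D ℓ) (proj₁ (coroot-kr-beside κ v)) after)))

  crossing-even : ∀ {v σ p ℓ} → v ℤ.- ρ σ p ≡ ℓ ℤ.* D → Σ ℤ λ t → v ≡ + 2 ℤ.* t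
  crossing-even {v} {σ} {p} {ℓ} at with ρ-even σ p
  ... | h , ρ≡2h = h ℤ.+ ℓ ℤ.* (+ 2 ℤ.* + n₀ ℤ.+ + 1) , (begin
    v                                          ≡⟨ split v (ρ σ p) ⟩
    (v ℤ.- ρ σ p) ℤ.+ ρ σ p                    ≡⟨ cong₂ ℤ._+_ (trans at (cong (ℓ ℤ.*_) D-even)) ρ≡2h ⟩
    ℓ ℤ.* (+ 2 ℤ.* (+ 2 ℤ.* + n₀ ℤ.+ + 1)) ℤ.+ + 2 ℤ.* h ≡⟨ factor ℓ h (+ 2 ℤ.* + n₀ ℤ.+ + 1) ⟩
    + 2 ℤ.* (h ℤ.+ ℓ ℤ.* (+ 2 ℤ.* + n₀ ℤ.+ + 1)) ∎)
    where
    open ≡-Reasoning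
    split : ∀ v r → v ≡ (v ℤ.- r) ℤ.+ r
    split = solve-∀
    factor : ∀ l h m → l ℤ.* (+ 2 ℤ.* m) ℤ.+ + 2 ℤ.* h ≡ + 2 ℤ.* (h ℤ.+ l ℤ.* m)
    factor = solve-∀

  R-generic-beside : ∀ {v} → (Σ ℤ λ t → v ≡ + 2 ℤ.* t) → Generic (R (v ℤ.+ + 1)) × Generic (R (v ℤ.- + 1))
  R-generic-beside (t , refl) =
    subst (Generic ∘ R) (plus-one t) (R-generic t) , subst (Generic ∘ R) (minus-one t) (R-generic (t ℤ.- + 1))
    where
    plus-one : ∀ t → + 1 ℤ.+ + 2 ℤ.* t ≡ + 2 ℤ.* t ℤ.+ + 1
    plus-one = solve-∀
    minus-one : ∀ t → + 1 ℤ.+ + 2 ℤ.* (t ℤ.- + 1) ≡ + 2 ℤ.* t ℤ.- + 1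
    minus-one = solve-∀

  crossing-step : ∀ {v σ p} (κ : KRoot σ p) → v ℤ.- ρ σ p ≡ level κ ℤ.* D →
                  Step (R (v ℤ.+ + 1)) (⊖ kr κ) (R (v ℤ.- + 1))
  crossing-step {v} {σ} {p} κ at =
    proj₁ generic , proj₂ generic , IsRoot-⊖ (kr-root κ) , ℤ.- level κ , (before , after) , only-wall
    where
    generic = R-generic-beside (crossing-even {v} {σ} {p} {level κ} at)
    before : coroot⟨ R (v ℤ.+ + 1) , ⊖ kr κ ⟩ ℚ.< toℚ (ℤ.- level κ)
    before = subst₂ ℚ._<_ (sym (coroot-⊖ (R (v ℤ.+ + 1)) (kr κ))) (sym (toℚ-neg (level κ))) (ℚP.neg-antimono-<
      (subst₂ ℚ._<_ (sym (toℚ≡/D (level κ))) (sym (proj₁ (coroot-kr-beside κ v)))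
        (/D-mono-< (subst (λ a → level κ ℤ.* D ℤ.< a ℤ.+ + 1) (sym at) (i<i+1 _)))))
    after : toℚ (ℤ.- level κ) ℚ.< coroot⟨ R (v ℤ.- + 1) , ⊖ kr κ ⟩
    after = subst₂ ℚ._<_ (sym (toℚ-neg (level κ))) (sym (coroot-⊖ (R (v ℤ.- + 1)) (kr κ))) (ℚP.neg-antimono-<
      (subst₂ ℚ._<_ (sym (proj₂ (coroot-kr-beside κ v))) (sym (toℚ≡/D (level κ)))
        (/D-mono-< (subst (λ a → a ℤ.- + 1 ℤ.< level κ ℤ.* D) (sym at) (i-1<i _)))))
    only-wall : ∀ α → IsPosRoot n α → ∀ m → Separates (R (v ℤ.+ + 1)) (R (v ℤ.- + 1)) α m →
                (α , m) ≈ₕ (⊖ kr κ , ℤ.- level κ)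
    only-wall α pr m separated with along pr
    ... | fixed unmoved-α =
      ⊥-elim (unseparated {ξ = R (v ℤ.+ + 1)} {R (v ℤ.- + 1)} {α} {m}
                (trans (unmoved-α (v ℤ.+ + 1)) (sym (unmoved-α (v ℤ.- + 1)))) separated)
    ... | moving κ' ± with ≈ₕ-of-± ± m
    ...   | ℓ' , ≈kr with same-crossing {v} κ κ' at (line-crossing {v} {ℓ = ℓ'} κ' (separated-≈ₕ {ξ = R (v ℤ.+ + 1)} {R (v ℤ.- + 1)} {α , m} ≈kr separated))
    ...     | ρ≡ρ' , level≡ℓ' =
      ≈ₕ-trans ≈kr (subst₂ (λ γ ℓ → (γ , ℓ) ≈ₕ (⊖ kr κ , ℤ.- level κ)) (kr-injective κ κ' ρ≡ρ') level≡ℓ'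
                      (≈ₕ-flip (kr κ) (level κ)))

  -- The chain Γ

  record Crossing (v : ℤ) (γ : Wt n) : Set where
    constructor crossing
    field
      {σ} : Sign
      {p} : ℕ
      κ   : KRoot σ p
      γ≡  : γ ≡ kr κ
      at  : v ℤ.- ρ σ p ≡ level κ ℤ.* D

  data Descent : ℤ → List (Wt n) → ℤ → Set where
    []  : ∀ {v} → Descent v [] v
    _∷_ : ∀ {v γ γs v'} → Crossing v γ → Descent (v ℤ.- + 2) γs v' → Descent v (γ ∷ γs) v'

  _++ᴰ_ : ∀ {a b c γs δs} → Descent a γs b → Descent b δs c → Descent a (γs ++ δs) c
  []      ++ᴰ e = e
  (x ∷ d) ++ᴰ e = x ∷ (d ++ᴰ e)

  descent-walk : ∀ {v γs v'} → Descent v γs v' → Generic (R (v' ℤ.+ + 1)) →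
                 Walk (R (v ℤ.+ + 1)) (L.map ⊖_ γs) (R (v' ℤ.+ + 1))
  descent-walk []                          generic = stop generic
  descent-walk {v} (crossing κ refl at ∷ d) generic =
    step (subst (Step (R (v ℤ.+ + 1)) (⊖ kr κ) ∘ R) (next v) (crossing-step {v} κ at)) (descent-walk d generic)
    where
    next : ∀ v → v ℤ.- + 1 ≡ (v ℤ.- + 2) ℤ.+ + 1
    next = solve-∀

  CrossingAt : Set
  CrossingAt = Σ ℤ λ u → Σ (Wt n) (Crossing u)

  crossings : ∀ {v γs v'} → Descent v γs v' → List CrossingAt
  crossings []                  = []
  crossings (_∷_ {v} {γ} x d)   = (v , γ , x) ∷ crossings d

  wallOf : CrossingAt → Hyperplane n
  wallOf (_ , _ , crossing κ _ _) = kr κ , level κ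

  walls : ∀ {v γs v'} → Descent v γs v' → List (Hyperplane n)
  walls d = L.map wallOf (crossings d)

  length-walls : ∀ {v γs v'} (d : Descent v γs v') → length (walls d) ≡ length γs
  length-walls []      = refl
  length-walls (_ ∷ d) = cong suc (length-walls d)

  -- Every kr κ pairs to 1 with ε_k, so no two of them are opposite.
  kr-not-opposite : ∀ {σ σ' p q} (κ : KRoot σ p) (κ' : KRoot σ' q) → kr κ ≢ ⊖ kr κ'
  kr-not-opposite κ κ' kr≡ = 1≢-1 (begin
    1ℚ                                  ≡⟨ solve 2 (λ a b → con 1ℚ := (a :+ con 1ℚ) :- a) refl a b ⟩
    (a ℚ.+ 1ℚ) ℚ.- a                    ≡⟨ cong (ℚ._- a) (trans (sym (coroot-kr-shift κ η)) (opposite (η +ₚ ptOf (ε k)))) ⟩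
    ℚ.- coroot⟨ η +ₚ ptOf (ε k) , kr κ' ⟩ ℚ.- a ≡⟨ cong₂ (λ s t → ℚ.- s ℚ.- t) (coroot-kr-shift κ' η) (opposite η) ⟩
    ℚ.- (b ℚ.+ 1ℚ) ℚ.- ℚ.- b            ≡⟨ solve 1 (λ b → :- (b :+ con 1ℚ) :- (:- b) := :- con 1ℚ) refl b ⟩
    ℚ.- 1ℚ                              ∎)
    where
    open ≡-Reasoning
    η = R (+ 0)
    a = coroot⟨ η , kr κ ⟩
    b = coroot⟨ η , kr κ' ⟩
    opposite : ∀ ξ → coroot⟨ ξ , kr κ ⟩ ≡ ℚ.- coroot⟨ ξ , kr κ' ⟩
    opposite ξ = trans (cong (λ γ → coroot⟨ ξ , γ ⟩) kr≡) (coroot-⊖ ξ (kr κ'))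
    1≢-1 : 1ℚ ≢ ℚ.- 1ℚ
    1≢-1 ()

  crossing-unique : ∀ x x' → wallOf x ≈ₕ wallOf x' → proj₁ x ≡ proj₁ x'
  crossing-unique (u , _ , crossing {σ} {p} κ _ at) (u' , _ , crossing {σ'} {p'} κ' _ at') (inj₁ (kr≡ , level≡)) = begin
    u                             ≡⟨ split u (ρ σ p) ⟩
    (u ℤ.- ρ σ p) ℤ.+ ρ σ p       ≡⟨ cong₂ ℤ._+_ (trans at (cong (ℤ._* D) level≡)) ρ≡ρ' ⟩
    level κ' ℤ.* D ℤ.+ ρ σ' p'    ≡⟨ cong (ℤ._+ ρ σ' p') (sym at') ⟩
    (u' ℤ.- ρ σ' p') ℤ.+ ρ σ' p'  ≡⟨ sym (split u' (ρ σ' p')) ⟩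
    u'                            ∎
    where
    open ≡-Reasoning
    split : ∀ v r → v ≡ (v ℤ.- r) ℤ.+ r
    split = solve-∀
    ρ≡ρ' : ρ σ p ≡ ρ σ' p'
    ρ≡ρ' = ℤP.neg-injective (subst₂ _≡_ (ℤP.+-identityˡ _) (ℤP.+-identityˡ _) (/D-injective
             (trans (sym (coroot-kr κ (+ 0))) (trans (cong (λ γ → coroot⟨ R (+ 0) , γ ⟩) kr≡) (coroot-kr κ' (+ 0))))))
  crossing-unique (_ , _ , crossing κ _ _) (_ , _ , crossing κ' _ _) (inj₂ (kr≡ , _)) = ⊥-elim (kr-not-opposite κ κ' kr≡)

  crossings-≤ : ∀ {v γs v'} (d : Descent v γs v') → All (λ x → proj₁ x ℤ.≤ v) (crossings d)
  crossings-≤ []                = []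
  crossings-≤ {v} (_ ∷ d) = ℤP.≤-refl ∷ All.map (λ u≤ → ℤP.≤-trans u≤ (ℤP.<⇒≤ (i-2<i v))) (crossings-≤ d)

  walls-apart : ∀ {v γs v'} (d : Descent v γs v') → AllPairs (λ h h' → ¬ h ≈ₕ h') (walls d)
  walls-apart d = AllPairsP.map⁺ {f = wallOf} (AllPairs.map (λ {x} {y} → distinct x y) (decreasing d))
    where
    decreasing : ∀ {v γs v'} (d : Descent v γs v') → AllPairs (λ x y → proj₁ y ℤ.< proj₁ x) (crossings d)
    decreasing []      = []
    decreasing {v} (_ ∷ d) = All.map (λ u≤ → ℤP.≤-<-trans u≤ (i-2<i v)) (crossings-≤ d) ∷ decreasing d
    distinct : ∀ x y → proj₁ y ℤ.< proj₁ x → ¬ wallOf x ≈ₕ wallOf y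
    distinct x y y<x walls≈ = ℤP.<-irrefl (sym (crossing-unique x y walls≈)) y<x

  walls-separate : ∀ {ξ η v γs v'} → InA∘ ξ → InA∘ (η +ₚ ptOf (ε k)) → (d : Descent v γs v') →
                   All (λ h → IsRoot n (proj₁ h) × Separated ξ η h) (walls d)
  walls-separate ξ∈A∘ η+ε∈A∘ []                    = []
  walls-separate {ξ} {η} ξ∈A∘ η+ε∈A∘ (crossing κ _ _ ∷ d) =
    (kr-root κ , wall-separates {ξ} {η} ξ∈A∘ η+ε∈A∘ κ) ∷ walls-separate {ξ} {η} ξ∈A∘ η+ε∈A∘ d

  descent-upTo : ∀ (f : ℕ → Wt n) (V : ℕ → ℤ) m → (∀ i → V (suc i) ≡ V i ℤ.- + 2) →
                 (∀ i → i ℕ.< m → Crossing (V i) (f i)) → Descent (V 0) (L.applyUpTo f m) (V m)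
  descent-upTo f V zero    next cross = []
  descent-upTo f V (suc m) next cross = cross 0 (s≤s z≤n) ∷
    subst (λ v → Descent v (L.applyUpTo (f ∘ suc) m) (V (suc m))) (next 0)
      (descent-upTo (f ∘ suc) (V ∘ suc) m (next ∘ suc) (λ i i<m → cross (suc i) (s≤s i<m)))

  descent-downFrom : ∀ (f : ℕ → Wt n) (V : ℕ → ℤ) m → (∀ i → V i ≡ V (suc i) ℤ.- + 2) →
                     (∀ i → i ℕ.< m → Crossing (V (suc i)) (f i)) → Descent (V m) (L.applyDownFrom f m) (V 0)
  descent-downFrom f V zero    next cross = []
  descent-downFrom f V (suc m) next cross = cross m (ℕP.n<1+n m) ∷
    subst (λ v → Descent v (L.applyDownFrom f m) (V 0)) (next m)
      (descent-downFrom f V m next (λ i i<m → cross i (ℕP.m<n⇒m<1+n i<m)))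

  descent-cast : ∀ {a a' b b' γs} → a ≡ a' → b ≡ b' → Descent a γs b → Descent a' γs b'
  descent-cast refl refl d = d

  n₀≡k₀+c : + n₀ ≡ + k₀ ℤ.+ + c
  n₀≡k₀+c = cong +_ (sym (ℕP.m+[n∸m]≡n k₀≤n₀))

  upper≤n : ∀ i → i ℕ.< c → suc k ℕ.+ i ≤ n
  upper≤n i i<c = subst (suc k ℕ.+ i ≤_) (ℕP.m+[n∸m]≡n k≤n)
    (subst (ℕ._≤ k ℕ.+ (n ∸ k)) (ℕP.+-suc k i) (ℕP.+-monoʳ-≤ k i<c))

  rises-by-2 : ∀ C I → ℤ.- + 2 ℤ.* (C ℤ.+ + 1 ℤ.- I) ≡ ℤ.- + 2 ℤ.* (C ℤ.+ + 1 ℤ.- (+ 1 ℤ.+ I)) ℤ.- + 2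
  rises-by-2 = solve-∀

  upper⁻-descent : Descent (+ 2 ℤ.* (+ c ℤ.- + 0)) (L.map (λ j → ⟨ k , j ⟩⁻) (range (suc k) (n ∸ k))) (+ 0)
  upper⁻-descent = subst (λ γs → Descent (V 0) γs (+ 0)) (sym (map-range _ (suc k) c))
    (descent-cast refl (last (+ c)) (descent-upTo _ V c (λ i → falls-by-2 (+ c) (+ i)) cross))
    where
    V : ℕ → ℤ
    V i = + 2 ℤ.* (+ c ℤ.- + i)
    last : ∀ C → + 2 ℤ.* (C ℤ.- C) ≡ + 0
    last = solve-∀
    falls-by-2 : ∀ C I → + 2 ℤ.* (C ℤ.- (+ 1 ℤ.+ I)) ≡ + 2 ℤ.* (C ℤ.- I) ℤ.- + 2
    falls-by-2 = solve-∀
    cross : ∀ i → i ℕ.< c → Crossing (V i) ⟨ k , suc k ℕ.+ i ⟩⁻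
    cross i i<c = crossing (upper⁻ (s≤s (ℕP.m≤m+n k i)) (upper≤n i i<c)) refl
      (trans (cong (ℤ._-_ (V i)) (trans (ℤP.+◃n≡+n _) (w-upper i i<c))) (ℤP.+-inverseʳ (V i)))

  long-descent : Descent (+ 0) (⟨ k , k ⟩⁺ ∷ []) (+ 0 ℤ.- + 2)
  long-descent = crossing long refl (cong (λ m → + 0 ℤ.- (Sign.- ◃ m)) w-k) ∷ []

  upper⁺-descent : Descent (+ 0 ℤ.- + 2) (L.map (λ j → ⟨ k , j ⟩⁺) (L.reverse (range (suc k) (n ∸ k))))
                           (ℤ.- + 2 ℤ.* (+ c ℤ.+ + 1 ℤ.- + 0))
  upper⁺-descent = subst (λ γs → Descent (+ 0 ℤ.- + 2) γs (V 0)) (sym (map-reverse-range _ (suc k) c))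
    (descent-cast (first (+ c)) refl (descent-downFrom _ V c (λ i → rises-by-2 (+ c) (+ i)) cross))
    where
    V : ℕ → ℤ
    V i = ℤ.- + 2 ℤ.* (+ c ℤ.+ + 1 ℤ.- + i)
    first : ∀ C → ℤ.- + 2 ℤ.* (C ℤ.+ + 1 ℤ.- C) ≡ + 0 ℤ.- + 2
    first = solve-∀
    at : ∀ C I → ℤ.- + 2 ℤ.* (C ℤ.+ + 1 ℤ.- (+ 1 ℤ.+ I)) ℤ.- ℤ.- (+ 2 ℤ.* (C ℤ.- I)) ≡ + 0
    at = solve-∀
    cross : ∀ i → i ℕ.< c → Crossing (V (suc i)) ⟨ k , suc k ℕ.+ i ⟩⁺
    cross i i<c = crossing (upper⁺ (s≤s (ℕP.m≤m+n k i)) (upper≤n i i<c)) refl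
      (trans (cong (ℤ._-_ (V (suc i))) (trans (ℤP.-◃n≡-n _) (cong ℤ.-_ (w-upper i i<c)))) (at (+ c) (+ i)))

  lower⁺-descent : Descent (ℤ.- + 2 ℤ.* (+ c ℤ.+ + 1 ℤ.- + 0)) (L.map (λ i → ⟨ i , k ⟩⁺) (L.reverse (range 1 (k ∸ 1))))
                           (+ 2 ℤ.* (+ n₀ ℤ.- + 0) ℤ.- D)
  lower⁺-descent = subst (λ γs → Descent (ℤ.- + 2 ℤ.* (+ c ℤ.+ + 1 ℤ.- + 0)) γs (+ 2 ℤ.* (+ n₀ ℤ.- + 0) ℤ.- D))
                         (sym (map-reverse-range _ 1 k₀))
    (descent-cast (trans (cong (λ N → ℤ.- + 2 ℤ.* (N ℤ.+ + 1 ℤ.- + k₀)) n₀≡k₀+c) (first (+ k₀) (+ c)))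
                  (trans (last (+ n₀)) (cong (λ d → + 2 ℤ.* (+ n₀ ℤ.- + 0) ℤ.- d) (sym D≡)))
                  (descent-downFrom _ V k₀ (λ q → rises-by-2 (+ n₀) (+ q)) cross))
    where
    V : ℕ → ℤ
    V i = ℤ.- + 2 ℤ.* (+ n₀ ℤ.+ + 1 ℤ.- + i)
    first : ∀ K C → ℤ.- + 2 ℤ.* ((K ℤ.+ C) ℤ.+ + 1 ℤ.- K) ≡ ℤ.- + 2 ℤ.* (C ℤ.+ + 1 ℤ.- + 0)
    first = solve-∀
    last : ∀ N → ℤ.- + 2 ℤ.* (N ℤ.+ + 1 ℤ.- + 0) ≡ + 2 ℤ.* (N ℤ.- + 0) ℤ.- (+ 4 ℤ.* N ℤ.+ + 2)
    last = solve-∀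
    at : ∀ N Q → ℤ.- + 2 ℤ.* (N ℤ.+ + 1 ℤ.- (+ 1 ℤ.+ Q)) ℤ.- ℤ.- (+ 2 ℤ.* (N ℤ.- Q)) ≡ + 0
    at = solve-∀
    cross : ∀ q → q ℕ.< k₀ → Crossing (V (suc q)) ⟨ suc q , k ⟩⁺
    cross q q<k₀ = crossing (lower⁺ (s≤s z≤n) (s≤s q<k₀)) refl
      (trans (cong (ℤ._-_ (V (suc q))) (trans (ℤP.-◃n≡-n _) (cong ℤ.-_ (w-lower q q<k₀)))) (at (+ n₀) (+ q)))

  lower⁻-descent : Descent (+ 2 ℤ.* (+ n₀ ℤ.- + 0) ℤ.- D) (L.map (λ i → ⊖ ⟨ i , k ⟩⁻) (range 1 (k ∸ 1)))
                           (+ 2 ℤ.* (+ n₀ ℤ.- + k₀) ℤ.- D)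
  lower⁻-descent = subst (λ γs → Descent (V 0) γs (V k₀)) (sym (map-range _ 1 k₀))
    (descent-upTo _ V k₀ (λ q → falls-by-2 (+ n₀) (+ q) D) cross)
    where
    V : ℕ → ℤ
    V i = + 2 ℤ.* (+ n₀ ℤ.- + i) ℤ.- D
    falls-by-2 : ∀ N Q d → + 2 ℤ.* (N ℤ.- (+ 1 ℤ.+ Q)) ℤ.- d ≡ (+ 2 ℤ.* (N ℤ.- Q) ℤ.- d) ℤ.- + 2
    falls-by-2 = solve-∀
    at : ∀ N Q d → (+ 2 ℤ.* (N ℤ.- Q) ℤ.- d) ℤ.- + 2 ℤ.* (N ℤ.- Q) ≡ ℤ.- + 1 ℤ.* d
    at = solve-∀
    cross : ∀ q → q ℕ.< k₀ → Crossing (V q) (⊖ ⟨ suc q , k ⟩⁻)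
    cross q q<k₀ = crossing (lower⁻ (s≤s z≤n) (s≤s q<k₀)) refl
      (trans (cong (ℤ._-_ (V q)) (trans (ℤP.+◃n≡+n _) (w-lower q q<k₀))) (at (+ n₀) (+ q) D))

  Γ-descent : Descent (+ 2 ℤ.* (+ c ℤ.- + 0)) Γ[ n , k ] (+ 2 ℤ.* (+ n₀ ℤ.- + k₀) ℤ.- D)
  Γ-descent = (upper⁻-descent ++ᴰ (long-descent ++ᴰ (upper⁺-descent ++ᴰ lower⁺-descent))) ++ᴰ lower⁻-descent

  μ : Wt n
  μ = (⊖ ϖ (k ∸ 1)) ⊕ ϖ k

  ⊖⊖μ≡ε : ⊖ (⊖ μ) ≡ ε k
  ⊖⊖μ≡ε = trans (⊖-involutive μ) (⊖-⊕-cancelˡ (ϖ k₀) (ε k))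

  end : ℤ
  end = + 2 ℤ.* (+ n₀ ℤ.- + k₀) ℤ.- D

  end-generic : Generic (R (end ℤ.+ + 1))
  end-generic = subst (Generic ∘ R) (trans (regroup (+ n₀) (+ k₀)) (cong (λ d → + 2 ℤ.* (+ n₀ ℤ.- + k₀) ℤ.- d ℤ.+ + 1) (sym D-even)))
    (R-generic ((+ n₀ ℤ.- + k₀) ℤ.- (+ 2 ℤ.* + n₀ ℤ.+ + 1)))
    where
    regroup : ∀ N K → + 1 ℤ.+ + 2 ℤ.* ((N ℤ.- K) ℤ.- (+ 2 ℤ.* N ℤ.+ + 1))
                    ≡ + 2 ℤ.* (N ℤ.- K) ℤ.- + 2 ℤ.* (+ 2 ℤ.* N ℤ.+ + 1) ℤ.+ + 1
    regroup = solve-∀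

  end-in-A₋μ : InA (⊖ μ) (R (end ℤ.+ + 1))
  end-in-A₋μ = subst InA∘ (sym (begin
    R (end ℤ.+ + 1) +ₚ ptOf (⊖ (⊖ μ))  ≡⟨ cong (λ a → R (end ℤ.+ + 1) +ₚ ptOf a) ⊖⊖μ≡ε ⟩
    R (end ℤ.+ + 1) +ₚ ptOf (ε k)      ≡⟨ R-shift (end ℤ.+ + 1) ⟩
    R (end ℤ.+ + 1 ℤ.+ D)              ≡⟨ cong (λ N → R (+ 2 ℤ.* (N ℤ.- + k₀) ℤ.- D ℤ.+ + 1 ℤ.+ D)) n₀≡k₀+c ⟩
    R (+ 2 ℤ.* ((+ k₀ ℤ.+ + c) ℤ.- + k₀) ℤ.- D ℤ.+ + 1 ℤ.+ D) ≡⟨ cong R (cancel (+ k₀) (+ c) D) ⟩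
    R u₀                               ∎)) start-in-A∘
    where
    open ≡-Reasoning
    cancel : ∀ K C d → + 2 ℤ.* ((K ℤ.+ C) ℤ.- K) ℤ.- d ℤ.+ + 1 ℤ.+ d ≡ + 1 ℤ.+ + 2 ℤ.* C
    cancel = solve-∀

  Γ-chain : IsChain μ Γ[ n , k ]
  Γ-chain = R (+ 2 ℤ.* (+ c ℤ.- + 0) ℤ.+ + 1) , R (end ℤ.+ + 1) ,
    subst InA∘ (cong R (u₀≡ (+ c))) start-in-A∘ , end-in-A₋μ , descent-walk Γ-descent end-generic
    where
    u₀≡ : ∀ C → + 1 ℤ.+ + 2 ℤ.* C ≡ + 2 ℤ.* (C ℤ.- + 0) ℤ.+ + 1
    u₀≡ = solve-∀

  Γ-reduced : ∀ ξ η βs → InA∘ ξ → InA (⊖ μ) η → Walk ξ βs η → length Γ[ n , k ] ≤ length βs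
  Γ-reduced ξ η βs ξ∈A∘ η∈A₋μ walk = subst (_≤ length βs) (length-walls Γ-descent)
    (walk-length≥ walk (walls Γ-descent) (walls-apart Γ-descent)
      (walls-separate {ξ} {η} ξ∈A∘ (subst (λ a → InA∘ (η +ₚ ptOf a)) ⊖⊖μ≡ε η∈A₋μ) Γ-descent))

lemma2p5 : (n k : ℕ) → 1 ≤ k → k ≤ n →
    IsReducedChain {n} ((⊖ ϖ (k ∸ 1)) ⊕ ϖ k) Γ[ n , k ]
lemma2p5 n        zero     ()      _
lemma2p5 zero     (suc k₀) _       ()
lemma2p5 (suc n₀) (suc k₀) _       (s≤s k₀≤n₀) = Γ-chain , Γ-reduced
  where open Line n₀ k₀ k₀≤n₀
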